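{- Let $\mathcal{C}$ be a full comprehension category satisfying condition (LF). If $\mathcal{C}$ has weakly stable binary sums, then the split comprehension category $\mathcal{C}_!$ has strictly stable binary sums.
   Context: A full comprehension category $\mathcal{C}=(\mathcal{C},\mathcal{T},p,\chi)$: a category $\mathcal{C}$, a cloven Grothendieck fibration $p:\mathcal{T}\to\mathcal{C}$, a fully faithful functor $\chi:\mathcal{T}\to\mathcal{C}^{\to}$ with $\mathrm{cod}\circ\chi=p$ sending cartesian arrows to pullback squares; split if the cleaving is strictly functorial. For $A\in\mathcal{T}(\Gamma)$, $\chi(A):\Gamma.A\to\Gamma$; display maps are composites of these. For $\sigma:\Delta\to\Gamma$, $A[\sigma]$ is the cleaving's reindexing and $\sigma.A:\Delta.A[\sigma]\to\Gamma.A$; $f[\sigma]$ denotes the induced reindexing of a map $f$ in a fibre (maps in fibres identified with maps over the base via $\chi$). A section of $A$ is a section of $\chi(A)$. Condition (LF): $\mathcal{C}$ has finite products, and for all $Z\xrightarrow{g}Y\xrightarrow{f}X$ with $f$ a display map and $g$ a display map or product projection, a dependent exponential exists (an object $\prod[f,g]$ of $\mathcal{C}/X$ with $\mathcal{C}/X(W,\prod[f,g])\cong\mathcal{C}/Y(W\times_XY,Z)$ naturally in $W\to X$). $\mathcal{C}_!$: same base; objects of $\mathcal{T}_!$ over $\Gamma$ are triples $A=(V_A,E_A,n_A)$, $V_A\in\mathcal{C}$, $E_A\in\mathcal{T}(V_A)$, $n_A:\Gamma\to V_A$, with $[A]:=E_A[n_A]$; morphisms $B\to A$ over $\sigma$ are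 morphisms $[B]\to[A]$ over $\sigma$ in $\mathcal{T}$; $(V_A,E_A,n_A)[\sigma]:=(V_A,E_A,n_A\circ\sigma)$ with the canonical cartesian map $[A[\sigma]]\to[A]$ (a split fibration); $\chi_!(A):=\chi([A])$. Binary sum for $A_1,A_2\in\mathcal{T}(\Gamma)$: $A_1+A_2\in\mathcal{T}(\Gamma)$ and maps $\nu_i:\Gamma.A_i\to\Gamma.(A_1+A_2)$ over $\Gamma$ such that for every $C\in\mathcal{T}(\Gamma.(A_1+A_2))$ and sections $t_i:\Gamma.A_i\to\Gamma.A_i.C[\nu_i]$ there is a section $[t_1,t_2]$ of $C$ with $[t_1,t_2]\circ\nu_i=(\nu_i.C)\circ t_i$. Weakly stable binary sums: every $\Gamma,A_1,A_2$ has a binary sum whose every reindexing $((A_1+A_2)[\sigma],\nu_1[\sigma],\nu_2[\sigma])$ is a binary sum for $A_1[\sigma],A_2[\sigma]$. Strictly stable binary sums (split case): functions choosing sums and copairs with $(A_1+A_2)[\sigma]=A_1[\sigma]+A_2[\sigma]$, $\nu_i[\sigma]=\nu_i$, $[t_1,t_2][\sigma]=[t_1[\sigma],t_2[\sigma]]$. -}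

module Defs where

open import Level using (Level; _⊔_) renaming (suc to lsuc)
open import Data.Product using (Σ; Σ-syntax; _×_; _,_; proj₁; proj₂)
open import Data.Sum using (_⊎_)
open import Function.Bundles using (_↔_; Inverse)
open import Relation.Binary.PropositionalEquality hiding ([_])
open ≡-Reasoning

record UniqueExists {a b} (A : Set a) (P : A → Set b) : Set (a ⊔ b) where
  field
    witness : A
    holds   : P witness
    unique  : ∀ y → P y → y ≡ witness
open UniqueExists public

record Category (o h : Level) : Set (lsuc (o ⊔ h)) where
  infixr 9 _∘_
  field
    Obj : Set o
    Hom : Obj → Obj → Set h
    id  : ∀ {X} → Hom X X
    _∘_ : ∀ {X Y Z} → Hom Y Z → Hom X Y → Hom X Z
    assoc : ∀ {W X Y Z} (f : Hom Y Z) (g : Hom X Y) (k : Hom W X) →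
            (f ∘ g) ∘ k ≡ f ∘ (g ∘ k)
    identityˡ : ∀ {X Y} (f : Hom X Y) → id ∘ f ≡ f
    identityʳ : ∀ {X Y} (f : Hom X Y) → f ∘ id ≡ f

module CatNotions {o h} (𝒞 : Category o h) where
  open Category 𝒞

  IsPullback : ∀ {P A B X} (a : Hom P A) (b : Hom P B) (f : Hom A X) (g : Hom B X) →
               Set (o ⊔ h)
  IsPullback {P} {A} {B} a b f g =
    ∀ {Q} (x : Hom Q A) (y : Hom Q B) → f ∘ x ≡ g ∘ y →
    UniqueExists (Hom Q P) (λ u → (a ∘ u ≡ x) × (b ∘ u ≡ y))

  IsProductCone : ∀ {P L R} (l : Hom P L) (r : Hom P R) → Set (o ⊔ h)
  IsProductCone {P} {L} {R} l r =
    ∀ {Q} (x : Hom Q L) (y : Hom Q R) →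
    UniqueExists (Hom Q P) (λ u → (l ∘ u ≡ x) × (r ∘ u ≡ y))

  IsProductProjection : ∀ {Z Y} (g : Hom Z Y) → Set (o ⊔ h)
  IsProductProjection {Z} {Y} g = Σ[ K ∈ Obj ] Σ[ k ∈ Hom Z K ] IsProductCone g k

  record HasFiniteProducts : Set (o ⊔ h) where
    field
      𝟙       : Obj
      !       : ∀ {X} → Hom X 𝟙
      !-unique : ∀ {X} (f : Hom X 𝟙) → f ≡ !
      _⊗_     : Obj → Obj → Obj
      π₁      : ∀ {L R} → Hom (L ⊗ R) L
      π₂      : ∀ {L R} → Hom (L ⊗ R) R
      product : ∀ {L R} → IsProductCone (π₁ {L} {R}) (π₂ {L} {R})

  SliceHom : ∀ {W E X} (e : Hom E X) (w : Hom W X) → Set h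
  SliceHom {W} {E} e w = Σ[ k ∈ Hom W E ] e ∘ k ≡ w

  precomp : ∀ {W₁ W₂ E X} {e : Hom E X} {w₁ : Hom W₁ X} {w₂ : Hom W₂ X} →
            SliceHom e w₁ → (u : Hom W₂ W₁) → w₁ ∘ u ≡ w₂ → SliceHom e w₂
  precomp {e = e} {w₁} {w₂} (k , ek) u wu =
    k ∘ u , (begin
      e ∘ (k ∘ u) ≡⟨ sym (assoc e k u) ⟩
      (e ∘ k) ∘ u ≡⟨ cong (_∘ u) ek ⟩
      w₁ ∘ u      ≡⟨ wu ⟩
      w₂          ∎)

  -- Dependent exponential  Π[f,g] ∈ C/X  for  Z --g--> Y --f--> X :
  -- C/X(W, Π[f,g]) ≅ C/Y(W ×_X Y, Z), naturally in (W → X), where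
  -- W ×_X Y ranges over (arbitrary) pullbacks of f along W → X.
  record DependentExponential {X Y Z} (f : Hom Y X) (g : Hom Z Y) : Set (o ⊔ h) where
    field
      Pi  : Obj
      pi  : Hom Pi X
      iso : ∀ {W W'} (w : Hom W X) (a : Hom W' W) (b : Hom W' Y) →
            w ∘ a ≡ f ∘ b → IsPullback a b w f →
            SliceHom pi w ↔ SliceHom g b
      natural :
        ∀ {W₁ W₁' W₂ W₂'}
          (w₁ : Hom W₁ X) (a₁ : Hom W₁' W₁) (b₁ : Hom W₁' Y)
          (sq₁ : w₁ ∘ a₁ ≡ f ∘ b₁) (pb₁ : IsPullback a₁ b₁ w₁ f)
          (w₂ : Hom W₂ X) (a₂ : Hom W₂' W₂) (b₂ : Hom W₂' Y)
          (sq₂ : w₂ ∘ a₂ ≡ f ∘ b₂) (pb₂ : IsPullback a₂ b₂ w₂ f)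
          (u : Hom W₂ W₁) (wu : w₁ ∘ u ≡ w₂)
          (u' : Hom W₂' W₁') → a₁ ∘ u' ≡ u ∘ a₂ → b₁ ∘ u' ≡ b₂ →
          (k : SliceHom pi w₁) →
          proj₁ (Inverse.to (iso w₂ a₂ b₂ sq₂ pb₂) (precomp k u wu))
            ≡ proj₁ (Inverse.to (iso w₁ a₁ b₁ sq₁ pb₁) k) ∘ u'

-- Since χ is fully faithful, morphisms of 𝒯 are identified (via χ) with
-- commuting squares of C between comprehensions; the data below is the
-- object part of 𝒯 and χ together with the cleaving, whose chosen
-- cartesian arrows χ sends to pullback squares.

record FullCompCat {o h} (𝒞 : Category o h) (t : Level) : Set (lsuc (o ⊔ h ⊔ t)) where
  open Category 𝒞
  open CatNotions 𝒞
  infixl 5 _▷_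
  infixl 7 _[_]
  field
    Ty   : Obj → Set t
    _▷_  : (Γ : Obj) → Ty Γ → Obj
    𝐩    : ∀ {Γ} (A : Ty Γ) → Hom (Γ ▷ A) Γ
    _[_] : ∀ {Γ Δ} → Ty Γ → Hom Δ Γ → Ty Δ
    𝐪    : ∀ {Γ Δ} (A : Ty Γ) (σ : Hom Δ Γ) → Hom (Δ ▷ A [ σ ]) (Γ ▷ A)
    𝐪-sq : ∀ {Γ Δ} (A : Ty Γ) (σ : Hom Δ Γ) → 𝐩 A ∘ 𝐪 A σ ≡ σ ∘ 𝐩 (A [ σ ])
    𝐪-pb : ∀ {Γ Δ} (A : Ty Γ) (σ : Hom Δ Γ) → IsPullback (𝐪 A σ) (𝐩 (A [ σ ])) (𝐩 A) σ

module CompNotions {o h t} {𝒞 : Category o h} (𝒯 : FullCompCat 𝒞 t) where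
  open Category 𝒞
  open CatNotions 𝒞
  open FullCompCat 𝒯

  data IsDisplay : ∀ {X Y} → Hom X Y → Set (o ⊔ h ⊔ t) where
    χ-display : ∀ {Γ} (A : Ty Γ) → IsDisplay (𝐩 A)
    ∘-display : ∀ {X Y Z} {f : Hom Y Z} {g : Hom X Y} →
                IsDisplay f → IsDisplay g → IsDisplay (f ∘ g)

  record LF : Set (o ⊔ h ⊔ t) where
    field
      finiteProducts : HasFiniteProducts
      depExp : ∀ {X Y Z} (f : Hom Y X) (g : Hom Z Y) → IsDisplay f →
               IsDisplay g ⊎ IsProductProjection g → DependentExponential f g

  Sect : ∀ {Γ} → Ty Γ → Set h
  Sect {Γ} A = Σ[ s ∈ Hom Γ (Γ ▷ A) ] 𝐩 A ∘ s ≡ id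

  -- maps Γ.A → Γ.B over Γ (= maps A → B in the fibre over Γ, via χ)
  OverMap : ∀ Γ → Ty Γ → Ty Γ → Set h
  OverMap Γ A B = Σ[ f ∈ Hom (Γ ▷ A) (Γ ▷ B) ] 𝐩 B ∘ f ≡ 𝐩 A

  reindexOver : ∀ {Γ Δ} (σ : Hom Δ Γ) {A B : Ty Γ} → OverMap Γ A B → OverMap Δ (A [ σ ]) (B [ σ ])
  reindexOver σ {A} {B} (f , fo) =
    witness U , proj₂ (holds U)
    where
    e : 𝐩 B ∘ (f ∘ 𝐪 A σ) ≡ σ ∘ 𝐩 (A [ σ ])
    e = begin
      𝐩 B ∘ (f ∘ 𝐪 A σ) ≡⟨ sym (assoc _ _ _) ⟩
      (𝐩 B ∘ f) ∘ 𝐪 A σ ≡⟨ cong (_∘ 𝐪 A σ) fo ⟩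
      𝐩 A ∘ 𝐪 A σ       ≡⟨ 𝐪-sq A σ ⟩
      σ ∘ 𝐩 (A [ σ ])   ∎
    U = 𝐪-pb B σ (f ∘ 𝐪 A σ) (𝐩 (A [ σ ])) e

  reindexOver-sq : ∀ {Γ Δ} (σ : Hom Δ Γ) {A B : Ty Γ} (f : OverMap Γ A B) →
                   𝐪 B σ ∘ proj₁ (reindexOver σ f) ≡ proj₁ f ∘ 𝐪 A σ
  reindexOver-sq σ {A} {B} (f , fo) =
    proj₁ (holds (𝐪-pb B σ (f ∘ 𝐪 A σ) (𝐩 (A [ σ ])) _))

  reindexSect : ∀ {Γ Δ} (τ : Hom Δ Γ) {A : Ty Γ} → Sect A → Sect (A [ τ ])
  reindexSect τ {A} (s , so) = witness U , proj₂ (holds U)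
    where
    e : 𝐩 A ∘ (s ∘ τ) ≡ τ ∘ id
    e = begin
      𝐩 A ∘ (s ∘ τ) ≡⟨ sym (assoc _ _ _) ⟩
      (𝐩 A ∘ s) ∘ τ ≡⟨ cong (_∘ τ) so ⟩
      id ∘ τ        ≡⟨ identityˡ τ ⟩
      τ             ≡⟨ sym (identityʳ τ) ⟩
      τ ∘ id        ∎
    U = 𝐪-pb A τ (s ∘ τ) id e

  IsBinarySum : ∀ {Γ} (A₁ A₂ S : Ty Γ) → OverMap Γ A₁ S → OverMap Γ A₂ S → Set (h ⊔ t)
  IsBinarySum {Γ} A₁ A₂ S (ν₁ , _) (ν₂ , _) =
    ∀ (C : Ty (Γ ▷ S)) (t₁ : Sect (C [ ν₁ ])) (t₂ : Sect (C [ ν₂ ])) →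
    Σ[ s ∈ Sect C ] (proj₁ s ∘ ν₁ ≡ 𝐪 C ν₁ ∘ proj₁ t₁)
                  × (proj₁ s ∘ ν₂ ≡ 𝐪 C ν₂ ∘ proj₁ t₂)

  HasWeaklyStableSums : Set (o ⊔ h ⊔ t)
  HasWeaklyStableSums =
    ∀ {Γ} (A₁ A₂ : Ty Γ) →
    Σ[ S ∈ Ty Γ ] Σ[ ν₁ ∈ OverMap Γ A₁ S ] Σ[ ν₂ ∈ OverMap Γ A₂ S ]
      IsBinarySum A₁ A₂ S ν₁ ν₂
      × (∀ {Δ} (σ : Hom Δ Γ) →
           IsBinarySum (A₁ [ σ ]) (A₂ [ σ ]) (S [ σ ]) (reindexOver σ ν₁) (reindexOver σ ν₂))

  -- the (object part of the) split laws of the cleaving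
  record SplitTy : Set (o ⊔ h ⊔ t) where
    field
      [id] : ∀ {Γ} (A : Ty Γ) → A [ id ] ≡ A
      [∘]  : ∀ {Γ Δ Θ} (A : Ty Γ) (σ : Hom Δ Γ) (τ : Hom Θ Δ) → A [ σ ∘ τ ] ≡ A [ σ ] [ τ ]

  castSect : ∀ {Γ} {C D : Ty Γ} → C ≡ D → Sect C → Sect D
  castSect refl s = s

  substTy : ∀ {Δ} {T T' : Ty Δ} → T ≡ T' → Ty (Δ ▷ T) → Ty (Δ ▷ T')
  substTy refl D = D

  substSect : ∀ {Δ} {T T' : Ty Δ} (e : T ≡ T') (D : Ty (Δ ▷ T)) → Sect D → Sect (substTy e D)
  substSect refl D s = s

  substOver : ∀ {Δ} {A T T' : Ty Δ} → T ≡ T' → OverMap Δ A T → OverMap Δ A T'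
  substOver refl f = f

  substTy-reindex : ∀ {Δ} {A T T' : Ty Δ} (e : T ≡ T') (D : Ty (Δ ▷ T)) (f : OverMap Δ A T) →
                    D [ proj₁ f ] ≡ substTy e D [ proj₁ (substOver e f) ]
  substTy-reindex refl D f = refl

  stableFamilyEq :
    SplitTy → ∀ {Γ Δ} (σ : Hom Δ Γ) {A S : Ty Γ} {T' : Ty Δ}
    (e : S [ σ ] ≡ T') (C : Ty (Γ ▷ S)) (ν : OverMap Γ A S) (ν' : OverMap Δ (A [ σ ]) T') →
    proj₁ (substOver e (reindexOver σ ν)) ≡ proj₁ ν' →
    C [ proj₁ ν ] [ 𝐪 A σ ] ≡ substTy e (C [ 𝐪 S σ ]) [ proj₁ ν' ]
  stableFamilyEq sp σ {A} {S} e C ν ν' eν = begin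
    C [ proj₁ ν ] [ 𝐪 A σ ]                          ≡⟨ sym ([∘] C (proj₁ ν) (𝐪 A σ)) ⟩
    C [ proj₁ ν ∘ 𝐪 A σ ]                            ≡⟨ cong (C [_]) (sym (reindexOver-sq σ ν)) ⟩
    C [ 𝐪 S σ ∘ proj₁ (reindexOver σ ν) ]            ≡⟨ [∘] C (𝐪 S σ) _ ⟩
    C [ 𝐪 S σ ] [ proj₁ (reindexOver σ ν) ]          ≡⟨ substTy-reindex e (C [ 𝐪 S σ ]) (reindexOver σ ν) ⟩
    substTy e (C [ 𝐪 S σ ]) [ proj₁ (substOver e (reindexOver σ ν)) ]
                                                     ≡⟨ cong (substTy e (C [ 𝐪 S σ ]) [_]) eν ⟩
    substTy e (C [ 𝐪 S σ ]) [ proj₁ ν' ]             ∎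
    where open SplitTy sp

  record StrictlyStableSums (sp : SplitTy) : Set (o ⊔ h ⊔ t) where
    infixl 6 _⊕_
    field
      _⊕_ : ∀ {Γ} → Ty Γ → Ty Γ → Ty Γ
      ν₁  : ∀ {Γ} (A₁ A₂ : Ty Γ) → OverMap Γ A₁ (A₁ ⊕ A₂)
      ν₂  : ∀ {Γ} (A₁ A₂ : Ty Γ) → OverMap Γ A₂ (A₁ ⊕ A₂)
      copair : ∀ {Γ} {A₁ A₂ : Ty Γ} (C : Ty (Γ ▷ A₁ ⊕ A₂)) →
               Sect (C [ proj₁ (ν₁ A₁ A₂) ]) → Sect (C [ proj₁ (ν₂ A₁ A₂) ]) → Sect C
      copair-ν₁ : ∀ {Γ} {A₁ A₂ : Ty Γ} (C : Ty (Γ ▷ A₁ ⊕ A₂))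
                  (t₁ : Sect (C [ proj₁ (ν₁ A₁ A₂) ])) (t₂ : Sect (C [ proj₁ (ν₂ A₁ A₂) ])) →
                  proj₁ (copair C t₁ t₂) ∘ proj₁ (ν₁ A₁ A₂) ≡ 𝐪 C (proj₁ (ν₁ A₁ A₂)) ∘ proj₁ t₁
      copair-ν₂ : ∀ {Γ} {A₁ A₂ : Ty Γ} (C : Ty (Γ ▷ A₁ ⊕ A₂))
                  (t₁ : Sect (C [ proj₁ (ν₁ A₁ A₂) ])) (t₂ : Sect (C [ proj₁ (ν₂ A₁ A₂) ])) →
                  proj₁ (copair C t₁ t₂) ∘ proj₁ (ν₂ A₁ A₂) ≡ 𝐪 C (proj₁ (ν₂ A₁ A₂)) ∘ proj₁ t₂
      ⊕-stable : ∀ {Γ Δ} (σ : Hom Δ Γ) (A₁ A₂ : Ty Γ) → (A₁ ⊕ A₂) [ σ ] ≡ A₁ [ σ ] ⊕ A₂ [ σ ]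
      ν₁-stable : ∀ {Γ Δ} (σ : Hom Δ Γ) (A₁ A₂ : Ty Γ) →
                  proj₁ (substOver (⊕-stable σ A₁ A₂) (reindexOver σ (ν₁ A₁ A₂)))
                    ≡ proj₁ (ν₁ (A₁ [ σ ]) (A₂ [ σ ]))
      ν₂-stable : ∀ {Γ Δ} (σ : Hom Δ Γ) (A₁ A₂ : Ty Γ) →
                  proj₁ (substOver (⊕-stable σ A₁ A₂) (reindexOver σ (ν₂ A₁ A₂)))
                    ≡ proj₁ (ν₂ (A₁ [ σ ]) (A₂ [ σ ]))
      copair-stable :
        ∀ {Γ Δ} (σ : Hom Δ Γ) (A₁ A₂ : Ty Γ) (C : Ty (Γ ▷ A₁ ⊕ A₂))
          (t₁ : Sect (C [ proj₁ (ν₁ A₁ A₂) ])) (t₂ : Sect (C [ proj₁ (ν₂ A₁ A₂) ])) →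
          proj₁ (substSect (⊕-stable σ A₁ A₂) (C [ 𝐪 (A₁ ⊕ A₂) σ ])
                           (reindexSect (𝐪 (A₁ ⊕ A₂) σ) (copair C t₁ t₂)))
          ≡ proj₁ (copair (substTy (⊕-stable σ A₁ A₂) (C [ 𝐪 (A₁ ⊕ A₂) σ ]))
                     (castSect (stableFamilyEq sp σ (⊕-stable σ A₁ A₂) C (ν₁ A₁ A₂)
                                  (ν₁ (A₁ [ σ ]) (A₂ [ σ ])) (ν₁-stable σ A₁ A₂))
                               (reindexSect (𝐪 A₁ σ) t₁))
                     (castSect (stableFamilyEq sp σ (⊕-stable σ A₁ A₂) C (ν₂ A₁ A₂)
                                  (ν₂ (A₁ [ σ ]) (A₂ [ σ ])) (ν₂-stable σ A₁ A₂))
                               (reindexSect (𝐪 A₂ σ) t₂)))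

module _ {o h t} {𝒞 : Category o h} (𝒯 : FullCompCat 𝒞 t) where
  open Category 𝒞
  open CatNotions 𝒞
  open FullCompCat 𝒯

  Ty! : Obj → Set (o ⊔ h ⊔ t)
  Ty! Γ = Σ[ V ∈ Obj ] Σ[ E ∈ Ty V ] Hom Γ V

  ⟦_⟧ : ∀ {Γ} → Ty! Γ → Ty Γ
  ⟦ V , E , n ⟧ = E [ n ]

  reindex! : ∀ {Γ Δ} → Ty! Γ → Hom Δ Γ → Ty! Δ
  reindex! (V , E , n) σ = V , E , n ∘ σ

  private
    qsq : ∀ {Γ Δ V} (E : Ty V) (n : Hom Γ V) (σ : Hom Δ Γ) →
          𝐩 E ∘ 𝐪 E (n ∘ σ) ≡ n ∘ (σ ∘ 𝐩 (E [ n ∘ σ ]))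
    qsq E n σ = trans (𝐪-sq E (n ∘ σ)) (assoc n σ _)

    U! : ∀ {Γ Δ V} (E : Ty V) (n : Hom Γ V) (σ : Hom Δ Γ) → _
    U! E n σ = 𝐪-pb E n (𝐪 E (n ∘ σ)) (σ ∘ 𝐩 (E [ n ∘ σ ])) (qsq E n σ)

  𝐪! : ∀ {Γ Δ} (A : Ty! Γ) (σ : Hom Δ Γ) → Hom (Δ ▷ ⟦ reindex! A σ ⟧) (Γ ▷ ⟦ A ⟧)
  𝐪! (V , E , n) σ = witness (U! E n σ)

  𝐪!-sq : ∀ {Γ Δ} (A : Ty! Γ) (σ : Hom Δ Γ) → 𝐩 ⟦ A ⟧ ∘ 𝐪! A σ ≡ σ ∘ 𝐩 ⟦ reindex! A σ ⟧
  𝐪!-sq (V , E , n) σ = proj₂ (holds (U! E n σ))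

  -- pullback pasting
  𝐪!-pb : ∀ {Γ Δ} (A : Ty! Γ) (σ : Hom Δ Γ) → IsPullback (𝐪! A σ) (𝐩 ⟦ reindex! A σ ⟧) (𝐩 ⟦ A ⟧) σ
  𝐪!-pb {Γ} {Δ} (V , E , n) σ {Q} x y e = record
    { witness = v
    ; holds   = uv≡x , b₃v≡y
    ; unique  = uniq
    }
    where
    a₂ = 𝐪 E n
    b₂ = 𝐩 (E [ n ])
    a₃ = 𝐪 E (n ∘ σ)
    b₃ = 𝐩 (E [ n ∘ σ ])
    u  = witness (U! E n σ)
    a₂u : a₂ ∘ u ≡ a₃
    a₂u = proj₁ (holds (U! E n σ))
    b₂u : b₂ ∘ u ≡ σ ∘ b₃
    b₂u = proj₂ (holds (U! E n σ))
    eO : 𝐩 E ∘ (a₂ ∘ x) ≡ (n ∘ σ) ∘ y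
    eO = begin
      𝐩 E ∘ (a₂ ∘ x) ≡⟨ sym (assoc _ _ _) ⟩
      (𝐩 E ∘ a₂) ∘ x ≡⟨ cong (_∘ x) (𝐪-sq E n) ⟩
      (n ∘ b₂) ∘ x   ≡⟨ assoc _ _ _ ⟩
      n ∘ (b₂ ∘ x)   ≡⟨ cong (n ∘_) e ⟩
      n ∘ (σ ∘ y)    ≡⟨ sym (assoc _ _ _) ⟩
      (n ∘ σ) ∘ y    ∎
    O = 𝐪-pb E (n ∘ σ) (a₂ ∘ x) y eO
    v = witness O
    a₃v : a₃ ∘ v ≡ a₂ ∘ x
    a₃v = proj₁ (holds O)
    b₃v≡y : b₃ ∘ v ≡ y
    b₃v≡y = proj₂ (holds O)
    eR : 𝐩 E ∘ (a₂ ∘ x) ≡ n ∘ (b₂ ∘ x)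
    eR = trans (sym (assoc _ _ _)) (trans (cong (_∘ x) (𝐪-sq E n)) (assoc _ _ _))
    R = 𝐪-pb E n (a₂ ∘ x) (b₂ ∘ x) eR
    uv≡x : u ∘ v ≡ x
    uv≡x = trans (unique R (u ∘ v) (p₁ , p₂)) (sym (unique R x (refl , refl)))
      where
      p₁ : a₂ ∘ (u ∘ v) ≡ a₂ ∘ x
      p₁ = trans (sym (assoc _ _ _)) (trans (cong (_∘ v) a₂u) a₃v)
      p₂ : b₂ ∘ (u ∘ v) ≡ b₂ ∘ x
      p₂ = begin
        b₂ ∘ (u ∘ v)   ≡⟨ sym (assoc _ _ _) ⟩
        (b₂ ∘ u) ∘ v   ≡⟨ cong (_∘ v) b₂u ⟩
        (σ ∘ b₃) ∘ v   ≡⟨ assoc _ _ _ ⟩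
        σ ∘ (b₃ ∘ v)   ≡⟨ cong (σ ∘_) b₃v≡y ⟩
        σ ∘ y          ≡⟨ sym e ⟩
        b₂ ∘ x         ∎
    uniq : ∀ v' → (u ∘ v' ≡ x) × (b₃ ∘ v' ≡ y) → v' ≡ v
    uniq v' (uv' , bv') = unique O v' (q₁ , bv')
      where
      q₁ : a₃ ∘ v' ≡ a₂ ∘ x
      q₁ = begin
        a₃ ∘ v'        ≡⟨ cong (_∘ v') (sym a₂u) ⟩
        (a₂ ∘ u) ∘ v'  ≡⟨ assoc _ _ _ ⟩
        a₂ ∘ (u ∘ v')  ≡⟨ cong (a₂ ∘_) uv' ⟩
        a₂ ∘ x         ∎

  _! : FullCompCat 𝒞 (o ⊔ h ⊔ t)
  _! = record
    { Ty   = Ty!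
    ; _▷_  = λ Γ A → Γ ▷ ⟦ A ⟧
    ; 𝐩    = λ A → 𝐩 ⟦ A ⟧
    ; _[_] = reindex!
    ; 𝐪    = 𝐪!
    ; 𝐪-sq = 𝐪!-sq
    ; 𝐪-pb = 𝐪!-pb
    }

  !-split : CompNotions.SplitTy _!
  !-split = record
    { [id] = λ { (V , E , n) → cong (λ m → V , E , m) (identityʳ n) }
    ; [∘]  = λ { (V , E , n) σ τ → cong (λ m → V , E , m) (sym (assoc n σ τ)) }
    }

module Submission where

-- A sum of (V₁, E₁, n₁) and (V₂, E₂, n₂) in 𝒞_! is (V₁ × V₂, S, ⟨n₁ , n₂⟩) with S a weakly stable sum of
-- E₁[π₁] and E₂[π₂] in 𝒯; reindexing along σ only changes ⟨n₁ , n₂⟩, so sums and injections are strictly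
-- stable. Copairs are chosen generically: for a family F over W, three dependent exponentials build an
-- object U₃ over V₁ × V₂ carrying universal copairing data (a map into W and two lifts through 𝐩 F), the weak
-- sum copairs this data once, and the copair of any data is the restriction of that one along its unique
-- classifying map into U₃. Uniqueness of classifying maps then gives [t₁ , t₂][σ] = [t₁[σ] , t₂[σ]].

open import Defs
open import Level using (Level)
open import Data.Product using (Σ-syntax; _×_; _,_; proj₁; proj₂)
open import Data.Sum using (inj₁; inj₂)
open import Function.Bundles using (_↔_; Inverse)
open import Relation.Binary.PropositionalEquality hiding ([_])
open import Axiom.UniquenessOfIdentityProofs.WithK using (uip)

module CategoryLemmas {o h} (𝒞 : Category o h) where
  open Category 𝒞
  open CatNotions 𝒞
  open ≡-Reasoning

  infixr 20 _⟩∘_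
  infixl 20 _∘⟨_

  _⟩∘_ : ∀ {A B C} (f : Hom B C) {g g' : Hom A B} → g ≡ g' → f ∘ g ≡ f ∘ g'
  f ⟩∘ e = cong (f ∘_) e

  _∘⟨_ : ∀ {A B C} {f f' : Hom B C} → f ≡ f' → (g : Hom A B) → f ∘ g ≡ f' ∘ g
  e ∘⟨ g = cong (_∘ g) e

  pullˡ : ∀ {A B C D} {f : Hom C D} {g : Hom B C} {fg : Hom B D} {k : Hom A B} →
          f ∘ g ≡ fg → f ∘ (g ∘ k) ≡ fg ∘ k
  pullˡ {f = f} {g} {k = k} e = trans (sym (assoc f g k)) (e ∘⟨ k)

  module _ {P A B X} {a : Hom P A} {b : Hom P B} {f : Hom A X} {g : Hom B X}
           (pb : IsPullback a b f g) where

    mediator : ∀ {Q} (x : Hom Q A) (y : Hom Q B) → f ∘ x ≡ g ∘ y → Hom Q P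
    mediator x y e = witness (pb x y e)

    mediator-a : ∀ {Q} (x : Hom Q A) (y : Hom Q B) (e : f ∘ x ≡ g ∘ y) → a ∘ mediator x y e ≡ x
    mediator-a x y e = proj₁ (holds (pb x y e))

    mediator-b : ∀ {Q} (x : Hom Q A) (y : Hom Q B) (e : f ∘ x ≡ g ∘ y) → b ∘ mediator x y e ≡ y
    mediator-b x y e = proj₂ (holds (pb x y e))

    mediator-unique : ∀ {Q} (x : Hom Q A) (y : Hom Q B) (e : f ∘ x ≡ g ∘ y) (u : Hom Q P) →
                      a ∘ u ≡ x → b ∘ u ≡ y → u ≡ mediator x y e
    mediator-unique x y e u p q = unique (pb x y e) u (p , q)

    pullback-jointly-monic : f ∘ a ≡ g ∘ b → ∀ {Q} (u v : Hom Q P) → a ∘ u ≡ a ∘ v → b ∘ u ≡ b ∘ v → u ≡ v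
    pullback-jointly-monic sq u v p q =
      trans (mediator-unique (a ∘ v) (b ∘ v) e u p q) (sym (mediator-unique (a ∘ v) (b ∘ v) e v refl refl))
      where
      e : f ∘ (a ∘ v) ≡ g ∘ (b ∘ v)
      e = trans (pullˡ sq) (assoc g b v)

  IsPullback-swap : ∀ {P A B X} {a : Hom P A} {b : Hom P B} {f : Hom A X} {g : Hom B X} →
                    IsPullback a b f g → IsPullback b a g f
  IsPullback-swap pb x y e = record
    { witness = witness U
    ; holds   = proj₂ (holds U) , proj₁ (holds U)
    ; unique  = λ v (p , q) → unique U v (q , p)
    }
    where U = pb y x (sym e)

  IsPullback-resp : ∀ {P A B X} {a a' : Hom P A} {b : Hom P B} {f : Hom A X} {g g' : Hom B X} →
                    a ≡ a' → g ≡ g' → IsPullback a b f g → IsPullback a' b f g'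
  IsPullback-resp refl refl pb = pb

  IsPullback-unglue : ∀ {Q A B X P C} {q₁ : Hom Q A} {q₂ : Hom Q B} {f : Hom A X} {g : Hom B X}
                      {p₁ : Hom P Q} {p₂ : Hom P C} {k : Hom C B} →
                      f ∘ q₁ ≡ g ∘ q₂ → IsPullback q₁ q₂ f g → q₂ ∘ p₁ ≡ k ∘ p₂ →
                      IsPullback (q₁ ∘ p₁) p₂ f (g ∘ k) → IsPullback p₁ p₂ q₂ k
  IsPullback-unglue {q₁ = q₁} {q₂} {f} {g} {p₁} {p₂} {k} sqR R sqL O x y e = record
    { witness = u
    ; holds   = p₁u≡x , mediator-b O (q₁ ∘ x) y e'
    ; unique  = λ v (p₁v , p₂v) → mediator-unique O (q₁ ∘ x) y e' v (trans (assoc q₁ p₁ v) (q₁ ⟩∘ p₁v)) p₂v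
    }
    where
    e' : f ∘ (q₁ ∘ x) ≡ (g ∘ k) ∘ y
    e' = begin
      f ∘ (q₁ ∘ x) ≡⟨ pullˡ sqR ⟩
      (g ∘ q₂) ∘ x ≡⟨ assoc g q₂ x ⟩
      g ∘ (q₂ ∘ x) ≡⟨ g ⟩∘ e ⟩
      g ∘ (k ∘ y)  ≡⟨ sym (assoc g k y) ⟩
      (g ∘ k) ∘ y  ∎
    u = mediator O (q₁ ∘ x) y e'
    p₁u≡x : p₁ ∘ u ≡ x
    p₁u≡x = pullback-jointly-monic R sqR (p₁ ∘ u) x
      (trans (sym (assoc q₁ p₁ u)) (mediator-a O (q₁ ∘ x) y e'))
      (begin
        q₂ ∘ (p₁ ∘ u) ≡⟨ pullˡ sqL ⟩
        (k ∘ p₂) ∘ u  ≡⟨ assoc k p₂ u ⟩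
        k ∘ (p₂ ∘ u)  ≡⟨ k ⟩∘ mediator-b O (q₁ ∘ x) y e' ⟩
        k ∘ y         ≡⟨ sym e ⟩
        q₂ ∘ x        ∎)

  SliceHom-≡ : ∀ {W E X} {e : Hom E X} {w : Hom W X} (k k' : SliceHom e w) → proj₁ k ≡ proj₁ k' → k ≡ k'
  SliceHom-≡ (k , p) (.k , q) refl = cong (k ,_) (uip p q)

  -- ev is the transpose of the identity of Π[f,g]; by naturality the transpose of any u : Γ → Π[f,g] is
  -- ev ∘ ū, where ū is the map of pullbacks induced by u.
  module Transpose {X Y Z} {f : Hom Y X} {g : Hom Z Y} (D : DependentExponential f g)
                   {P} (a : Hom P (DependentExponential.Pi D)) (b : Hom P Y)
                   (sq : DependentExponential.pi D ∘ a ≡ f ∘ b)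
                   (pb : IsPullback a b (DependentExponential.pi D) f) where
    open DependentExponential D

    private
      idSlice : SliceHom pi pi
      idSlice = id , identityʳ pi

    ev : Hom P Z
    ev = proj₁ (Inverse.to (iso pi a b sq pb) idSlice)

    ev-g : g ∘ ev ≡ b
    ev-g = proj₂ (Inverse.to (iso pi a b sq pb) idSlice)

    module OverPullback {Γ P'} (w : Hom Γ X) (a' : Hom P' Γ) (b' : Hom P' Y) (sq' : w ∘ a' ≡ f ∘ b')
             (pb' : IsPullback a' b' w f) where
      private
        I : SliceHom pi w ↔ SliceHom g b'
        I = iso w a' b' sq' pb'

        transpose-ev : (u : Hom Γ Pi) (pu : pi ∘ u ≡ w) (ū : Hom P' P) → a ∘ ū ≡ u ∘ a' → b ∘ ū ≡ b' →
                       proj₁ (Inverse.to I (u , pu)) ≡ ev ∘ ū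
        transpose-ev u pu ū e₁ e₂ =
          trans (cong (λ k → proj₁ (Inverse.to I k)) (SliceHom-≡ (u , pu) (precomp idSlice u pu) (sym (identityˡ u))))
                (natural pi a b sq pb w a' b' sq' pb' u pu ū e₁ e₂ idSlice)

      curry : SliceHom g b' → Hom Γ Pi
      curry k = proj₁ (Inverse.from I k)

      curry-pi : (k : SliceHom g b') → pi ∘ curry k ≡ w
      curry-pi k = proj₂ (Inverse.from I k)

      ev-curry : (k : SliceHom g b') (ū : Hom P' P) → a ∘ ū ≡ curry k ∘ a' → b ∘ ū ≡ b' → ev ∘ ū ≡ proj₁ k
      ev-curry k ū e₁ e₂ =
        trans (sym (transpose-ev (curry k) (curry-pi k) ū e₁ e₂)) (cong proj₁ (Inverse.inverseˡ I refl))

      curry-unique : (k : SliceHom g b') (u : Hom Γ Pi) (pu : pi ∘ u ≡ w) (ū : Hom P' P) →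
                     a ∘ ū ≡ u ∘ a' → b ∘ ū ≡ b' → ev ∘ ū ≡ proj₁ k → u ≡ curry k
      curry-unique k u pu ū e₁ e₂ e₃ =
        cong proj₁ (sym (Inverse.inverseʳ I (sym (SliceHom-≡ _ k (trans (transpose-ev u pu ū e₁ e₂) e₃)))))

module ComprehensionLemmas {o h t} {𝒞 : Category o h} (𝒯 : FullCompCat 𝒞 t) where
  open Category 𝒞
  open CatNotions 𝒞
  open FullCompCat 𝒯
  open CompNotions 𝒯
  open CategoryLemmas 𝒞
  open ≡-Reasoning

  module _ {Γ Δ} (A : Ty Γ) (σ : Hom Δ Γ) where
    𝐪-pair : ∀ {Q} (x : Hom Q (Γ ▷ A)) (y : Hom Q Δ) → 𝐩 A ∘ x ≡ σ ∘ y → Hom Q (Δ ▷ A [ σ ])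
    𝐪-pair = mediator (𝐪-pb A σ)

    𝐪-pair-𝐪 : ∀ {Q} (x : Hom Q (Γ ▷ A)) (y : Hom Q Δ) (e : 𝐩 A ∘ x ≡ σ ∘ y) → 𝐪 A σ ∘ 𝐪-pair x y e ≡ x
    𝐪-pair-𝐪 = mediator-a (𝐪-pb A σ)

    𝐪-pair-𝐩 : ∀ {Q} (x : Hom Q (Γ ▷ A)) (y : Hom Q Δ) (e : 𝐩 A ∘ x ≡ σ ∘ y) → 𝐩 (A [ σ ]) ∘ 𝐪-pair x y e ≡ y
    𝐪-pair-𝐩 = mediator-b (𝐪-pb A σ)

    𝐪-pair-unique : ∀ {Q} (x : Hom Q (Γ ▷ A)) (y : Hom Q Δ) (e : 𝐩 A ∘ x ≡ σ ∘ y) (u : Hom Q (Δ ▷ A [ σ ])) →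
                    𝐪 A σ ∘ u ≡ x → 𝐩 (A [ σ ]) ∘ u ≡ y → u ≡ 𝐪-pair x y e
    𝐪-pair-unique = mediator-unique (𝐪-pb A σ)

    𝐪-ext : ∀ {Q} (u v : Hom Q (Δ ▷ A [ σ ])) → 𝐪 A σ ∘ u ≡ 𝐪 A σ ∘ v → 𝐩 (A [ σ ]) ∘ u ≡ 𝐩 (A [ σ ]) ∘ v → u ≡ v
    𝐪-ext = pullback-jointly-monic (𝐪-pb A σ) (𝐪-sq A σ)

  -- With hc = refl this is definitionally the cartesian map 𝐪 of 𝒞_!; taking the equation as an argument
  -- lets composites of lifts be compared without transport.
  lift : ∀ {X Y Z} (A : Ty X) (β : Hom Y X) (c : Hom Z Y) {n : Hom Z X} → β ∘ c ≡ n →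
         Hom (Z ▷ A [ n ]) (Y ▷ A [ β ])
  lift A β c {n} hc = 𝐪-pair A β (𝐪 A n) (c ∘ 𝐩 (A [ n ]))
    (trans (𝐪-sq A n) (trans (sym hc ∘⟨ 𝐩 (A [ n ])) (assoc β c (𝐩 (A [ n ])))))

  module _ {X Y Z} (A : Ty X) (β : Hom Y X) (c : Hom Z Y) {n : Hom Z X} (hc : β ∘ c ≡ n) where
    lift-𝐪 : 𝐪 A β ∘ lift A β c hc ≡ 𝐪 A n
    lift-𝐪 = 𝐪-pair-𝐪 A β _ _ _

    lift-𝐩 : 𝐩 (A [ β ]) ∘ lift A β c hc ≡ c ∘ 𝐩 (A [ n ])
    lift-𝐩 = 𝐪-pair-𝐩 A β _ _ _

    lift-pb : IsPullback (𝐩 (A [ n ])) (lift A β c hc) c (𝐩 (A [ β ]))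
    lift-pb = IsPullback-swap (IsPullback-unglue (𝐪-sq A β) (𝐪-pb A β) lift-𝐩
                (IsPullback-resp (sym lift-𝐪) (sym hc) (𝐪-pb A n)))

  lift-∘ : ∀ {X Y Z Z'} (A : Ty X) (β : Hom Y X) {c : Hom Z Y} {d : Hom Z' Z} {e : Hom Z' Y} {n k}
           (hc : β ∘ c ≡ n) (hd : n ∘ d ≡ k) (he : β ∘ e ≡ k) → c ∘ d ≡ e →
           lift A β c hc ∘ lift A n d hd ≡ lift A β e he
  lift-∘ A β {c} {d} {e} {n} {k} hc hd he cd≡e = 𝐪-pair-unique A β _ _ _ _
    (trans (pullˡ (lift-𝐪 A β c hc)) (lift-𝐪 A n d hd))
    (begin
      𝐩 (A [ β ]) ∘ (lift A β c hc ∘ lift A n d hd) ≡⟨ pullˡ (lift-𝐩 A β c hc) ⟩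
      (c ∘ 𝐩 (A [ n ])) ∘ lift A n d hd             ≡⟨ assoc c _ _ ⟩
      c ∘ (𝐩 (A [ n ]) ∘ lift A n d hd)             ≡⟨ c ⟩∘ lift-𝐩 A n d hd ⟩
      c ∘ (d ∘ 𝐩 (A [ k ]))                         ≡⟨ sym (assoc c d _) ⟩
      (c ∘ d) ∘ 𝐩 (A [ k ])                         ≡⟨ cd≡e ∘⟨ 𝐩 (A [ k ]) ⟩
      e ∘ 𝐩 (A [ k ])                               ∎)

  reindexOver-lift : ∀ {X Y Z} (β : Hom Y X) (c : Hom Z Y) {n : Hom Z X} (hc : β ∘ c ≡ n) {A B : Ty X}
                     (ν : OverMap X A B) →
                     proj₁ (reindexOver β ν) ∘ lift A β c hc ≡ lift B β c hc ∘ proj₁ (reindexOver n ν)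
  reindexOver-lift β c hc {A} {B} ν@(f , _) = 𝐪-ext B β _ _
    (begin
      𝐪 B β ∘ (νβ ∘ lift A β c hc)        ≡⟨ pullˡ (reindexOver-sq β ν) ⟩
      (f ∘ 𝐪 A β) ∘ lift A β c hc         ≡⟨ assoc f _ _ ⟩
      f ∘ (𝐪 A β ∘ lift A β c hc)         ≡⟨ f ⟩∘ lift-𝐪 A β c hc ⟩
      f ∘ 𝐪 A _                           ≡⟨ sym (reindexOver-sq _ ν) ⟩
      𝐪 B _ ∘ νn                          ≡⟨ sym (pullˡ (lift-𝐪 B β c hc)) ⟩
      𝐪 B β ∘ (lift B β c hc ∘ νn)        ∎)
    (begin
      𝐩 (B [ β ]) ∘ (νβ ∘ lift A β c hc)  ≡⟨ pullˡ (proj₂ (reindexOver β ν)) ⟩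
      𝐩 (A [ β ]) ∘ lift A β c hc         ≡⟨ lift-𝐩 A β c hc ⟩
      c ∘ 𝐩 (A [ _ ])                     ≡⟨ c ⟩∘ sym (proj₂ (reindexOver _ ν)) ⟩
      c ∘ (𝐩 (B [ _ ]) ∘ νn)              ≡⟨ sym (assoc c _ _) ⟩
      (c ∘ 𝐩 (B [ _ ])) ∘ νn              ≡⟨ sym (pullˡ (lift-𝐩 B β c hc)) ⟩
      𝐩 (B [ β ]) ∘ (lift B β c hc ∘ νn)  ∎)
    where
    νβ = proj₁ (reindexOver β ν)
    νn = proj₁ (reindexOver _ ν)

  -- Needed because the cleaving of 𝒯 is not split: A[π][β] is only isomorphic to A[π ∘ β].
  lift₂ : ∀ {X V B Z} (A : Ty X) (π : Hom V X) (β : Hom B V) (c : Hom Z B) {n : Hom Z V} {nᵢ : Hom Z X} →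
          β ∘ c ≡ n → π ∘ n ≡ nᵢ → Hom (Z ▷ A [ nᵢ ]) (B ▷ A [ π ] [ β ])
  lift₂ A π β c {n} {nᵢ} hc hᵢ = 𝐪-pair (A [ π ]) β (lift A π n hᵢ) (c ∘ 𝐩 (A [ nᵢ ]))
    (trans (lift-𝐩 A π n hᵢ) (trans (sym hc ∘⟨ 𝐩 (A [ nᵢ ])) (assoc β c (𝐩 (A [ nᵢ ])))))

  module _ {X V B Z} (A : Ty X) (π : Hom V X) (β : Hom B V) (c : Hom Z B) {n : Hom Z V} {nᵢ : Hom Z X}
           (hc : β ∘ c ≡ n) (hᵢ : π ∘ n ≡ nᵢ) where
    lift₂-𝐪 : 𝐪 (A [ π ]) β ∘ lift₂ A π β c hc hᵢ ≡ lift A π n hᵢ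
    lift₂-𝐪 = 𝐪-pair-𝐪 (A [ π ]) β _ _ _

    lift₂-𝐩 : 𝐩 (A [ π ] [ β ]) ∘ lift₂ A π β c hc hᵢ ≡ c ∘ 𝐩 (A [ nᵢ ])
    lift₂-𝐩 = 𝐪-pair-𝐩 (A [ π ]) β _ _ _

    lift₂-pb : IsPullback (𝐩 (A [ nᵢ ])) (lift₂ A π β c hc hᵢ) c (𝐩 (A [ π ] [ β ]))
    lift₂-pb = IsPullback-swap (IsPullback-unglue (𝐪-sq (A [ π ]) β) (𝐪-pb (A [ π ]) β) lift₂-𝐩
                 (IsPullback-resp (sym lift₂-𝐪) (sym hc) (IsPullback-swap (lift-pb A π n hᵢ))))

  lift-lift₂ : ∀ {X V B B' Z} (A : Ty X) (π : Hom V X) (β : Hom B V) (γ : Hom B' B) {β' : Hom B' V}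
               {c : Hom Z B'} {c' : Hom Z B} {n : Hom Z V} {nᵢ : Hom Z X}
               (hγ : β ∘ γ ≡ β') (hc : β' ∘ c ≡ n) (hc' : β ∘ c' ≡ n) (hᵢ : π ∘ n ≡ nᵢ) → γ ∘ c ≡ c' →
               lift (A [ π ]) β γ hγ ∘ lift₂ A π β' c hc hᵢ ≡ lift₂ A π β c' hc' hᵢ
  lift-lift₂ A π β γ {β'} {c} {c'} {nᵢ = nᵢ} hγ hc hc' hᵢ γc≡c' = 𝐪-pair-unique (A [ π ]) β _ _ _ _
    (trans (pullˡ (lift-𝐪 (A [ π ]) β γ hγ)) (lift₂-𝐪 A π β' c hc hᵢ))
    (begin
      𝐩 (A [ π ] [ β ]) ∘ (lift (A [ π ]) β γ hγ ∘ lift₂ A π β' c hc hᵢ) ≡⟨ pullˡ (lift-𝐩 (A [ π ]) β γ hγ) ⟩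
      (γ ∘ 𝐩 (A [ π ] [ β' ])) ∘ lift₂ A π β' c hc hᵢ                 ≡⟨ assoc γ _ _ ⟩
      γ ∘ (𝐩 (A [ π ] [ β' ]) ∘ lift₂ A π β' c hc hᵢ)                 ≡⟨ γ ⟩∘ lift₂-𝐩 A π β' c hc hᵢ ⟩
      γ ∘ (c ∘ 𝐩 (A [ nᵢ ]))                                           ≡⟨ pullˡ γc≡c' ⟩
      c' ∘ 𝐩 (A [ nᵢ ])                                                ∎)

  lift₂-lift : ∀ {X V B Z Z'} (A : Ty X) (π : Hom V X) (β : Hom B V) {c : Hom Z B} {d : Hom Z' Z} {e : Hom Z' B}
               {n : Hom Z V} {n' : Hom Z' V} {nᵢ : Hom Z X} {k : Hom Z' X}
               (hc : β ∘ c ≡ n) (hᵢ : π ∘ n ≡ nᵢ) (hd : nᵢ ∘ d ≡ k) (he : β ∘ e ≡ n') (hᵢ' : π ∘ n' ≡ k) →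
               c ∘ d ≡ e → lift₂ A π β c hc hᵢ ∘ lift A nᵢ d hd ≡ lift₂ A π β e he hᵢ'
  lift₂-lift A π β {c} {d} {e} {n} {n'} {nᵢ} {k} hc hᵢ hd he hᵢ' cd≡e = 𝐪-pair-unique (A [ π ]) β _ _ _ _
    (begin
      𝐪 (A [ π ]) β ∘ (lift₂ A π β c hc hᵢ ∘ lift A nᵢ d hd) ≡⟨ pullˡ (lift₂-𝐪 A π β c hc hᵢ) ⟩
      lift A π n hᵢ ∘ lift A nᵢ d hd                         ≡⟨ lift-∘ A π hᵢ hd hᵢ' nd≡n' ⟩
      lift A π n' hᵢ'                                        ∎)
    (begin
      𝐩 (A [ π ] [ β ]) ∘ (lift₂ A π β c hc hᵢ ∘ lift A nᵢ d hd) ≡⟨ pullˡ (lift₂-𝐩 A π β c hc hᵢ) ⟩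
      (c ∘ 𝐩 (A [ nᵢ ])) ∘ lift A nᵢ d hd                        ≡⟨ assoc c _ _ ⟩
      c ∘ (𝐩 (A [ nᵢ ]) ∘ lift A nᵢ d hd)                        ≡⟨ c ⟩∘ lift-𝐩 A nᵢ d hd ⟩
      c ∘ (d ∘ 𝐩 (A [ k ]))                                      ≡⟨ pullˡ cd≡e ⟩
      e ∘ 𝐩 (A [ k ])                                            ∎)
    where
    nd≡n' : n ∘ d ≡ n'
    nd≡n' = begin
      n ∘ d       ≡⟨ sym hc ∘⟨ d ⟩
      (β ∘ c) ∘ d ≡⟨ assoc β c d ⟩
      β ∘ (c ∘ d) ≡⟨ β ⟩∘ cd≡e ⟩
      β ∘ e       ≡⟨ he ⟩
      n'          ∎

  module _ {X Γ} (A : Ty X) (m : Hom Γ X) where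
    toSlice : Sect (A [ m ]) → SliceHom (𝐩 A) m
    toSlice (s , ps) = 𝐪 A m ∘ s , (begin
      𝐩 A ∘ (𝐪 A m ∘ s)       ≡⟨ pullˡ (𝐪-sq A m) ⟩
      (m ∘ 𝐩 (A [ m ])) ∘ s   ≡⟨ assoc m _ s ⟩
      m ∘ (𝐩 (A [ m ]) ∘ s)   ≡⟨ m ⟩∘ ps ⟩
      m ∘ id                  ≡⟨ identityʳ m ⟩
      m                       ∎)

    fromSlice : SliceHom (𝐩 A) m → Sect (A [ m ])
    fromSlice (s , ps) = 𝐪-pair A m s id e , 𝐪-pair-𝐩 A m s id e
      where e = trans ps (sym (identityʳ m))

    toSlice-fromSlice : (s : SliceHom (𝐩 A) m) → proj₁ (toSlice (fromSlice s)) ≡ proj₁ s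
    toSlice-fromSlice (s , ps) = 𝐪-pair-𝐪 A m s id _

  section-restriction : ∀ {X Γ Δ} (A : Ty X) (m : Hom Γ X) (ν : Hom Δ Γ) (s : Sect (A [ m ])) (t : Sect (A [ m ∘ ν ])) →
                        proj₁ (toSlice A m s) ∘ ν ≡ proj₁ (toSlice A (m ∘ ν) t) → proj₁ s ∘ ν ≡ lift A m ν refl ∘ proj₁ t
  section-restriction A m ν (s , ps) (t , pt) e = 𝐪-ext A m _ _
    (begin
      𝐪 A m ∘ (s ∘ ν)                  ≡⟨ sym (assoc _ s ν) ⟩
      (𝐪 A m ∘ s) ∘ ν                  ≡⟨ e ⟩
      𝐪 A (m ∘ ν) ∘ t                  ≡⟨ sym (pullˡ (lift-𝐪 A m ν refl)) ⟩
      𝐪 A m ∘ (lift A m ν refl ∘ t)    ∎)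
    (begin
      𝐩 (A [ m ]) ∘ (s ∘ ν)                 ≡⟨ pullˡ ps ⟩
      id ∘ ν                                ≡⟨ identityˡ ν ⟩
      ν                                     ≡⟨ sym (identityʳ ν) ⟩
      ν ∘ id                                ≡⟨ ν ⟩∘ sym pt ⟩
      ν ∘ (𝐩 (A [ m ∘ ν ]) ∘ t)             ≡⟨ sym (assoc ν _ t) ⟩
      (ν ∘ 𝐩 (A [ m ∘ ν ])) ∘ t             ≡⟨ sym (pullˡ (lift-𝐩 A m ν refl)) ⟩
      𝐩 (A [ m ]) ∘ (lift A m ν refl ∘ t)   ∎)

module WeakSumsToStrict {o h t} {𝒞 : Category o h} (𝒯 : FullCompCat 𝒞 t)
                        (lf : CompNotions.LF 𝒯) (ws : CompNotions.HasWeaklyStableSums 𝒯) where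
  open Category 𝒞
  open CatNotions 𝒞
  open FullCompCat 𝒯
  open CompNotions 𝒯
  open CategoryLemmas 𝒞
  open ComprehensionLemmas 𝒯
  open LF lf
  open HasFiniteProducts finiteProducts using (_⊗_; π₁; π₂; product)
  open ≡-Reasoning

  ⟨_,_⟩ : ∀ {Q L R} → Hom Q L → Hom Q R → Hom Q (L ⊗ R)
  ⟨ x , y ⟩ = witness (product x y)

  ⟨⟩-π₁ : ∀ {Q L R} (x : Hom Q L) (y : Hom Q R) → π₁ ∘ ⟨ x , y ⟩ ≡ x
  ⟨⟩-π₁ x y = proj₁ (holds (product x y))

  ⟨⟩-π₂ : ∀ {Q L R} (x : Hom Q L) (y : Hom Q R) → π₂ ∘ ⟨ x , y ⟩ ≡ y
  ⟨⟩-π₂ x y = proj₂ (holds (product x y))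

  ⟨⟩-unique : ∀ {Q L R} (x : Hom Q L) (y : Hom Q R) (u : Hom Q (L ⊗ R)) → π₁ ∘ u ≡ x → π₂ ∘ u ≡ y → u ≡ ⟨ x , y ⟩
  ⟨⟩-unique x y u p q = unique (product x y) u (p , q)

  ⟨⟩-∘ : ∀ {Q Q' L R} (x : Hom Q L) (y : Hom Q R) (σ : Hom Q' Q) → ⟨ x , y ⟩ ∘ σ ≡ ⟨ x ∘ σ , y ∘ σ ⟩
  ⟨⟩-∘ x y σ = ⟨⟩-unique _ _ _ (pullˡ (⟨⟩-π₁ x y)) (pullˡ (⟨⟩-π₂ x y))

  module N = CompNotions (𝒯 !)

  toSlice-reindexSect! : ∀ {X Y W} (F : Ty W) (a : Hom X W) (τ : Hom Y X) (s : N.Sect {X} (W , F , a)) →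
                         proj₁ (toSlice F (a ∘ τ) (N.reindexSect τ s)) ≡ proj₁ (toSlice F a s) ∘ τ
  toSlice-reindexSect! F a τ s = trans (𝐪-pair-𝐪 F (a ∘ τ) _ _ _) (sym (assoc _ _ τ))

  toSlice-castSect! : ∀ {X W} (F : Ty W) {a b : Hom X W} (q : _≡_ {A = Ty! 𝒯 X} (W , F , a) (W , F , b))
                      (s : N.Sect {X} (W , F , a)) → proj₁ (toSlice F b (N.castSect q s)) ≡ proj₁ (toSlice F a s)
  toSlice-castSect! F refl s = refl

  module SumOf {V₁ V₂} (E₁ : Ty V₁) (E₂ : Ty V₂) where
    V : Obj
    V = V₁ ⊗ V₂

    S : Ty V
    S = proj₁ (ws (E₁ [ π₁ ]) (E₂ [ π₂ ]))

    ν̄₁ : OverMap V (E₁ [ π₁ ]) S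
    ν̄₁ = proj₁ (proj₂ (ws (E₁ [ π₁ ]) (E₂ [ π₂ ])))

    ν̄₂ : OverMap V (E₂ [ π₂ ]) S
    ν̄₂ = proj₁ (proj₂ (proj₂ (ws (E₁ [ π₁ ]) (E₂ [ π₂ ]))))

    stable : ∀ {Δ} (σ : Hom Δ V) →
             IsBinarySum (E₁ [ π₁ ] [ σ ]) (E₂ [ π₂ ] [ σ ]) (S [ σ ]) (reindexOver σ ν̄₁) (reindexOver σ ν̄₂)
    stable = proj₂ (proj₂ (proj₂ (proj₂ (ws (E₁ [ π₁ ]) (E₂ [ π₂ ])))))

    module _ {Vᵢ} (Eᵢ : Ty Vᵢ) (πᵢ : Hom V Vᵢ) (ν̄ : OverMap V (Eᵢ [ πᵢ ]) S) where
      ι : ∀ {Γ} (n : Hom Γ V) {nᵢ : Hom Γ Vᵢ} → πᵢ ∘ n ≡ nᵢ → Hom (Γ ▷ Eᵢ [ nᵢ ]) (Γ ▷ S [ n ])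
      ι n hᵢ = proj₁ (reindexOver n ν̄) ∘ lift₂ Eᵢ πᵢ n id (identityʳ n) hᵢ

      ι-𝐩 : ∀ {Γ} (n : Hom Γ V) {nᵢ : Hom Γ Vᵢ} (hᵢ : πᵢ ∘ n ≡ nᵢ) → 𝐩 (S [ n ]) ∘ ι n hᵢ ≡ 𝐩 (Eᵢ [ nᵢ ])
      ι-𝐩 n hᵢ = trans (pullˡ (proj₂ (reindexOver n ν̄)))
                       (trans (lift₂-𝐩 Eᵢ πᵢ n id (identityʳ n) hᵢ) (identityˡ _))

      lift-ι : ∀ {Γ B} (β : Hom B V) (c : Hom Γ B) {n : Hom Γ V} (hc : β ∘ c ≡ n) {nᵢ : Hom Γ Vᵢ} (hᵢ : πᵢ ∘ n ≡ nᵢ) →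
               lift S β c hc ∘ ι n hᵢ ≡ proj₁ (reindexOver β ν̄) ∘ lift₂ Eᵢ πᵢ β c hc hᵢ
      lift-ι β c {n} hc hᵢ = begin
        lift S β c hc ∘ (νn ∘ ρ)                   ≡⟨ sym (assoc _ νn ρ) ⟩
        (lift S β c hc ∘ νn) ∘ ρ                   ≡⟨ sym (reindexOver-lift β c hc ν̄) ∘⟨ ρ ⟩
        (νβ ∘ lift (Eᵢ [ πᵢ ]) β c hc) ∘ ρ         ≡⟨ assoc νβ _ ρ ⟩
        νβ ∘ (lift (Eᵢ [ πᵢ ]) β c hc ∘ ρ)         ≡⟨ νβ ⟩∘ lift-lift₂ Eᵢ πᵢ β c hc (identityʳ n) hc hᵢ (identityʳ c) ⟩
        νβ ∘ lift₂ Eᵢ πᵢ β c hc hᵢ                 ∎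
        where
        ρ = lift₂ Eᵢ πᵢ n id (identityʳ n) hᵢ
        νn = proj₁ (reindexOver n ν̄)
        νβ = proj₁ (reindexOver β ν̄)

      ι-reindex : ∀ {Γ Δ} (σ : Hom Δ Γ) (n : Hom Γ V) {nᵢ : Hom Γ Vᵢ} (hᵢ : πᵢ ∘ n ≡ nᵢ)
                  (hᵢ' : πᵢ ∘ (n ∘ σ) ≡ nᵢ ∘ σ) →
                  lift S n σ refl ∘ ι (n ∘ σ) hᵢ' ≡ ι n hᵢ ∘ lift Eᵢ nᵢ σ refl
      ι-reindex σ n hᵢ hᵢ' = begin
        lift S n σ refl ∘ ι (n ∘ σ) hᵢ'                        ≡⟨ lift-ι n σ refl hᵢ' ⟩
        νn ∘ lift₂ Eᵢ πᵢ n σ refl hᵢ'                          ≡⟨ νn ⟩∘ sym (lift₂-lift Eᵢ πᵢ n (identityʳ n) hᵢ refl refl hᵢ' (identityˡ σ)) ⟩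
        νn ∘ (lift₂ Eᵢ πᵢ n id (identityʳ n) hᵢ ∘ lift Eᵢ _ σ refl) ≡⟨ sym (assoc νn _ _) ⟩
        ι n hᵢ ∘ lift Eᵢ _ σ refl                              ∎
        where νn = proj₁ (reindexOver n ν̄)

    ι₁ : ∀ {Γ} (n : Hom Γ V) {n₁ : Hom Γ V₁} → π₁ ∘ n ≡ n₁ → Hom (Γ ▷ E₁ [ n₁ ]) (Γ ▷ S [ n ])
    ι₁ = ι E₁ π₁ ν̄₁

    ι₂ : ∀ {Γ} (n : Hom Γ V) {n₂ : Hom Γ V₂} → π₂ ∘ n ≡ n₂ → Hom (Γ ▷ E₂ [ n₂ ]) (Γ ▷ S [ n ])
    ι₂ = ι E₂ π₂ ν̄₂

    -- U₁ classifies maps m : Γ.S[n] → W, U₂ adds a lift t₁ of m ∘ ι₁ through 𝐩 F, and U₃ a lift t₂ of m ∘ ι₂.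
    module Universal {W} (F : Ty W) where
      private
        D₀ : DependentExponential (𝐩 S) (π₁ {V ▷ S} {W})
        D₀ = depExp (𝐩 S) π₁ (χ-display S) (inj₂ (W , π₂ , product))
        module D₀ = DependentExponential D₀
        module T₀ = Transpose D₀ (𝐩 (S [ D₀.pi ])) (𝐪 S D₀.pi) (sym (𝐪-sq S D₀.pi)) (IsPullback-swap (𝐪-pb S D₀.pi))

      U₁ : Obj
      U₁ = D₀.Pi

      u₁ : Hom U₁ V
      u₁ = D₀.pi

      m₁ : Hom (U₁ ▷ S [ u₁ ]) W
      m₁ = π₂ ∘ T₀.ev

      module ClassifyBase {Γ} (n : Hom Γ V) (m : Hom (Γ ▷ S [ n ]) W) where
        private
          k : SliceHom π₁ (𝐪 S n)
          k = ⟨ 𝐪 S n , m ⟩ , ⟨⟩-π₁ _ _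
          module C = T₀.OverPullback n (𝐩 (S [ n ])) (𝐪 S n) (sym (𝐪-sq S n)) (IsPullback-swap (𝐪-pb S n))

        classifyM : Hom Γ U₁
        classifyM = C.curry k

        classifyM-u₁ : u₁ ∘ classifyM ≡ n
        classifyM-u₁ = C.curry-pi k

        classifyM-m : ∀ hc → m₁ ∘ lift S u₁ classifyM hc ≡ m
        classifyM-m hc = begin
          (π₂ ∘ T₀.ev) ∘ lift S u₁ classifyM hc ≡⟨ assoc π₂ _ _ ⟩
          π₂ ∘ (T₀.ev ∘ lift S u₁ classifyM hc) ≡⟨ π₂ ⟩∘ C.ev-curry k _ (lift-𝐩 S u₁ classifyM hc)
                                                                         (lift-𝐪 S u₁ classifyM hc) ⟩
          π₂ ∘ ⟨ 𝐪 S n , m ⟩                    ≡⟨ ⟨⟩-π₂ _ _ ⟩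
          m                                     ∎

        classifyM-unique : ∀ u (hu : u₁ ∘ u ≡ n) → m₁ ∘ lift S u₁ u hu ≡ m → u ≡ classifyM
        classifyM-unique u hu e = C.curry-unique k u hu _ (lift-𝐩 S u₁ u hu) (lift-𝐪 S u₁ u hu)
          (⟨⟩-unique _ _ _ (trans (pullˡ T₀.ev-g) (lift-𝐪 S u₁ u hu)) (trans (sym (assoc _ _ _)) e))

      module Extension {Vᵢ} (Eᵢ : Ty Vᵢ) (πᵢ : Hom V Vᵢ) (ν̄ : OverMap V (Eᵢ [ πᵢ ]) S)
                       {B} (β : Hom B V) (M : Hom (B ▷ S [ β ]) W) where
        private
          ν : Hom (B ▷ Eᵢ [ πᵢ ] [ β ]) (B ▷ S [ β ])
          ν = proj₁ (reindexOver β ν̄)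
          D : DependentExponential (𝐩 (Eᵢ [ πᵢ ] [ β ])) (𝐩 (F [ M ∘ ν ]))
          D = depExp _ _ (χ-display _) (inj₁ (χ-display _))
          module D = DependentExponential D
          module T = Transpose D (𝐩 (Eᵢ [ πᵢ ] [ β ∘ D.pi ])) (lift (Eᵢ [ πᵢ ]) β D.pi refl)
                       (sym (lift-𝐩 (Eᵢ [ πᵢ ]) β D.pi refl)) (lift-pb (Eᵢ [ πᵢ ]) β D.pi refl)

        U : Obj
        U = D.Pi

        p : Hom U B
        p = D.pi

        t̂ : Hom (U ▷ Eᵢ [ πᵢ ] [ β ∘ p ]) (W ▷ F)
        t̂ = 𝐪 F (M ∘ ν) ∘ T.ev

        t̂-𝐩 : 𝐩 F ∘ t̂ ≡ M ∘ (ν ∘ lift (Eᵢ [ πᵢ ]) β p refl)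
        t̂-𝐩 = begin
          𝐩 F ∘ (𝐪 F (M ∘ ν) ∘ T.ev)             ≡⟨ pullˡ (𝐪-sq F (M ∘ ν)) ⟩
          ((M ∘ ν) ∘ 𝐩 (F [ M ∘ ν ])) ∘ T.ev     ≡⟨ assoc _ _ _ ⟩
          (M ∘ ν) ∘ (𝐩 (F [ M ∘ ν ]) ∘ T.ev)     ≡⟨ (M ∘ ν) ⟩∘ T.ev-g ⟩
          (M ∘ ν) ∘ lift (Eᵢ [ πᵢ ]) β p refl    ≡⟨ assoc _ _ _ ⟩
          M ∘ (ν ∘ lift (Eᵢ [ πᵢ ]) β p refl)    ∎

        module Extend {Γ} {n : Hom Γ V} {nᵢ : Hom Γ Vᵢ} (hᵢ : πᵢ ∘ n ≡ nᵢ) (c : Hom Γ B) (hc : β ∘ c ≡ n)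
                      (t : Hom (Γ ▷ Eᵢ [ nᵢ ]) (W ▷ F)) (et : 𝐩 F ∘ t ≡ (M ∘ lift S β c hc) ∘ ι Eᵢ πᵢ ν̄ n hᵢ) where
          private
            b : Hom (Γ ▷ Eᵢ [ nᵢ ]) (B ▷ Eᵢ [ πᵢ ] [ β ])
            b = lift₂ Eᵢ πᵢ β c hc hᵢ
            e : 𝐩 F ∘ t ≡ (M ∘ ν) ∘ b
            e = begin
              𝐩 F ∘ t                                  ≡⟨ et ⟩
              (M ∘ lift S β c hc) ∘ ι Eᵢ πᵢ ν̄ n hᵢ     ≡⟨ assoc M _ _ ⟩
              M ∘ (lift S β c hc ∘ ι Eᵢ πᵢ ν̄ n hᵢ)     ≡⟨ M ⟩∘ lift-ι Eᵢ πᵢ ν̄ β c hc hᵢ ⟩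
              M ∘ (ν ∘ b)                              ≡⟨ sym (assoc M ν b) ⟩
              (M ∘ ν) ∘ b                              ∎
            k : SliceHom (𝐩 (F [ M ∘ ν ])) b
            k = 𝐪-pair F (M ∘ ν) t b e , 𝐪-pair-𝐩 F (M ∘ ν) t b e
            module C = T.OverPullback c (𝐩 (Eᵢ [ nᵢ ])) b (sym (lift₂-𝐩 Eᵢ πᵢ β c hc hᵢ)) (lift₂-pb Eᵢ πᵢ β c hc hᵢ)

            lift-lift₂-p : ∀ {u} (h : (β ∘ p) ∘ u ≡ n) → p ∘ u ≡ c →
                           lift (Eᵢ [ πᵢ ]) β p refl ∘ lift₂ Eᵢ πᵢ (β ∘ p) u h hᵢ ≡ b
            lift-lift₂-p h = lift-lift₂ Eᵢ πᵢ β p refl h hc hᵢ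

          extend : Hom Γ U
          extend = C.curry k

          extend-p : p ∘ extend ≡ c
          extend-p = C.curry-pi k

          extend-t̂ : ∀ h → t̂ ∘ lift₂ Eᵢ πᵢ (β ∘ p) extend h hᵢ ≡ t
          extend-t̂ h = begin
            (𝐪 F (M ∘ ν) ∘ T.ev) ∘ ū     ≡⟨ assoc _ T.ev ū ⟩
            𝐪 F (M ∘ ν) ∘ (T.ev ∘ ū)     ≡⟨ 𝐪 F (M ∘ ν) ⟩∘ C.ev-curry k ū (lift₂-𝐩 Eᵢ πᵢ (β ∘ p) extend h hᵢ)
                                                                          (lift-lift₂-p h extend-p) ⟩
            𝐪 F (M ∘ ν) ∘ proj₁ k        ≡⟨ 𝐪-pair-𝐪 F (M ∘ ν) t b e ⟩
            t                            ∎
            where ū = lift₂ Eᵢ πᵢ (β ∘ p) extend h hᵢ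

          extend-unique : ∀ u (pu : p ∘ u ≡ c) h → t̂ ∘ lift₂ Eᵢ πᵢ (β ∘ p) u h hᵢ ≡ t → u ≡ extend
          extend-unique u pu h eu = C.curry-unique k u pu ū (lift₂-𝐩 Eᵢ πᵢ (β ∘ p) u h hᵢ) (lift-lift₂-p h pu)
            (𝐪-pair-unique F (M ∘ ν) t b e (T.ev ∘ ū) (trans (sym (assoc _ T.ev ū)) eu)
               (trans (pullˡ T.ev-g) (lift-lift₂-p h pu)))
            where ū = lift₂ Eᵢ πᵢ (β ∘ p) u h hᵢ

      module Ext₁ = Extension E₁ π₁ ν̄₁ u₁ m₁

      U₂ : Obj
      U₂ = Ext₁.U

      u₂ : Hom U₂ V
      u₂ = u₁ ∘ Ext₁.p

      m₂ : Hom (U₂ ▷ S [ u₂ ]) W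
      m₂ = m₁ ∘ lift S u₁ Ext₁.p refl

      module Ext₂ = Extension E₂ π₂ ν̄₂ u₂ m₂

      U₃ : Obj
      U₃ = Ext₂.U

      τ : Hom U₃ V
      τ = u₂ ∘ Ext₂.p

      m̂ : Hom (U₃ ▷ S [ τ ]) W
      m̂ = m₂ ∘ lift S u₂ Ext₂.p refl

      t̂₁ : Hom (U₃ ▷ E₁ [ π₁ ] [ τ ]) (W ▷ F)
      t̂₁ = Ext₁.t̂ ∘ lift (E₁ [ π₁ ]) u₂ Ext₂.p refl

      t̂₂ : Hom (U₃ ▷ E₂ [ π₂ ] [ τ ]) (W ▷ F)
      t̂₂ = Ext₂.t̂

      m₂-lift : ∀ {Γ} {n : Hom Γ V} {c₂ : Hom Γ U₂} {c₁ : Hom Γ U₁} (h₂ : u₂ ∘ c₂ ≡ n) (h₁ : u₁ ∘ c₁ ≡ n) →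
                Ext₁.p ∘ c₂ ≡ c₁ → m₂ ∘ lift S u₂ c₂ h₂ ≡ m₁ ∘ lift S u₁ c₁ h₁
      m₂-lift h₂ h₁ e = trans (assoc m₁ _ _) (m₁ ⟩∘ lift-∘ S u₁ refl h₂ h₁ e)

      m̂-lift : ∀ {Γ} {n : Hom Γ V} {c : Hom Γ U₃} {c₂ : Hom Γ U₂} {c₁ : Hom Γ U₁}
               (hc : τ ∘ c ≡ n) (h₂ : u₂ ∘ c₂ ≡ n) (h₁ : u₁ ∘ c₁ ≡ n) →
               Ext₂.p ∘ c ≡ c₂ → Ext₁.p ∘ c₂ ≡ c₁ → m̂ ∘ lift S τ c hc ≡ m₁ ∘ lift S u₁ c₁ h₁
      m̂-lift hc h₂ h₁ e₂ e₁ = trans (assoc m₂ _ _) (trans (m₂ ⟩∘ lift-∘ S u₂ refl hc h₂ e₂) (m₂-lift h₂ h₁ e₁))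

      t̂₁-lift : ∀ {Γ} {n : Hom Γ V} {n₁ : Hom Γ V₁} {c : Hom Γ U₃} {c₂ : Hom Γ U₂}
                (hc : τ ∘ c ≡ n) (h₂ : u₂ ∘ c₂ ≡ n) (h₁ : π₁ ∘ n ≡ n₁) → Ext₂.p ∘ c ≡ c₂ →
                t̂₁ ∘ lift₂ E₁ π₁ τ c hc h₁ ≡ Ext₁.t̂ ∘ lift₂ E₁ π₁ u₂ c₂ h₂ h₁
      t̂₁-lift hc h₂ h₁ e = trans (assoc Ext₁.t̂ _ _) (Ext₁.t̂ ⟩∘ lift-lift₂ E₁ π₁ u₂ Ext₂.p refl hc h₂ h₁ e)

      restrict-over : ∀ {Eᵢ : Ty V} {B B'} {β : Hom B V} (M : Hom (B ▷ S [ β ]) W) (γ : Hom B' B)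
                      (ν̄ : OverMap V Eᵢ S) →
                      M ∘ (proj₁ (reindexOver β ν̄) ∘ lift Eᵢ β γ refl) ≡ (M ∘ lift S β γ refl) ∘ proj₁ (reindexOver (β ∘ γ) ν̄)
      restrict-over {β = β} M γ ν̄ = trans (M ⟩∘ reindexOver-lift β γ refl ν̄) (sym (assoc M _ _))

      t̂₁-𝐩 : 𝐩 F ∘ t̂₁ ≡ m̂ ∘ proj₁ (reindexOver τ ν̄₁)
      t̂₁-𝐩 = begin
        𝐩 F ∘ (Ext₁.t̂ ∘ L)                                                      ≡⟨ pullˡ Ext₁.t̂-𝐩 ⟩
        (m₁ ∘ (proj₁ (reindexOver u₁ ν̄₁) ∘ lift (E₁ [ π₁ ]) u₁ Ext₁.p refl)) ∘ L ≡⟨ restrict-over m₁ Ext₁.p ν̄₁ ∘⟨ L ⟩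
        (m₂ ∘ proj₁ (reindexOver u₂ ν̄₁)) ∘ L                                  ≡⟨ assoc m₂ _ L ⟩
        m₂ ∘ (proj₁ (reindexOver u₂ ν̄₁) ∘ L)                                  ≡⟨ restrict-over m₂ Ext₂.p ν̄₁ ⟩
        m̂ ∘ proj₁ (reindexOver τ ν̄₁)                                          ∎
        where L = lift (E₁ [ π₁ ]) u₂ Ext₂.p refl

      t̂₂-𝐩 : 𝐩 F ∘ t̂₂ ≡ m̂ ∘ proj₁ (reindexOver τ ν̄₂)
      t̂₂-𝐩 = trans Ext₂.t̂-𝐩 (restrict-over m₂ Ext₂.p ν̄₂)

      private
        sectionOf : ∀ {E' : Ty V} (ν̂ : Hom (U₃ ▷ E' [ τ ]) (U₃ ▷ S [ τ ])) (t̂ : Hom (U₃ ▷ E' [ τ ]) (W ▷ F)) →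
                    𝐩 F ∘ t̂ ≡ m̂ ∘ ν̂ → Sect (F [ m̂ ] [ ν̂ ])
        sectionOf ν̂ t̂ e = fromSlice (F [ m̂ ]) ν̂ (𝐪-pair F m̂ t̂ ν̂ e , 𝐪-pair-𝐩 F m̂ t̂ ν̂ e)

        sectionOf-𝐪 : ∀ {E' : Ty V} (ν̂ : Hom (U₃ ▷ E' [ τ ]) (U₃ ▷ S [ τ ])) (t̂ : Hom (U₃ ▷ E' [ τ ]) (W ▷ F))
                      (e : 𝐩 F ∘ t̂ ≡ m̂ ∘ ν̂) → 𝐪 F m̂ ∘ (𝐪 (F [ m̂ ]) ν̂ ∘ proj₁ (sectionOf ν̂ t̂ e)) ≡ t̂
        sectionOf-𝐪 ν̂ t̂ e = trans (𝐪 F m̂ ⟩∘ toSlice-fromSlice (F [ m̂ ]) ν̂ _) (𝐪-pair-𝐪 F m̂ t̂ ν̂ e)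

        s₁ : Sect (F [ m̂ ] [ proj₁ (reindexOver τ ν̄₁) ])
        s₁ = sectionOf _ t̂₁ t̂₁-𝐩

        s₂ : Sect (F [ m̂ ] [ proj₁ (reindexOver τ ν̄₂) ])
        s₂ = sectionOf _ t̂₂ t̂₂-𝐩

        universal : Σ[ s ∈ Sect (F [ m̂ ]) ]
                      (proj₁ s ∘ proj₁ (reindexOver τ ν̄₁) ≡ 𝐪 (F [ m̂ ]) (proj₁ (reindexOver τ ν̄₁)) ∘ proj₁ s₁)
                    × (proj₁ s ∘ proj₁ (reindexOver τ ν̄₂) ≡ 𝐪 (F [ m̂ ]) (proj₁ (reindexOver τ ν̄₂)) ∘ proj₁ s₂)
        universal = stable τ (F [ m̂ ]) s₁ s₂

      ŝ : Hom (U₃ ▷ S [ τ ]) (W ▷ F)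
      ŝ = proj₁ (toSlice F m̂ (proj₁ universal))

      ŝ-𝐩 : 𝐩 F ∘ ŝ ≡ m̂
      ŝ-𝐩 = proj₂ (toSlice F m̂ (proj₁ universal))

      ŝ-ν₁ : ŝ ∘ proj₁ (reindexOver τ ν̄₁) ≡ t̂₁
      ŝ-ν₁ = trans (assoc _ _ _) (trans (𝐪 F m̂ ⟩∘ proj₁ (proj₂ universal)) (sectionOf-𝐪 _ t̂₁ t̂₁-𝐩))

      ŝ-ν₂ : ŝ ∘ proj₁ (reindexOver τ ν̄₂) ≡ t̂₂
      ŝ-ν₂ = trans (assoc _ _ _) (trans (𝐪 F m̂ ⟩∘ proj₂ (proj₂ universal)) (sectionOf-𝐪 _ t̂₂ t̂₂-𝐩))

      module Classify {Γ} {n : Hom Γ V} {n₁ : Hom Γ V₁} {n₂ : Hom Γ V₂} (h₁ : π₁ ∘ n ≡ n₁) (h₂ : π₂ ∘ n ≡ n₂)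
                      (m : Hom (Γ ▷ S [ n ]) W)
                      (t₁ : Hom (Γ ▷ E₁ [ n₁ ]) (W ▷ F)) (et₁ : 𝐩 F ∘ t₁ ≡ m ∘ ι₁ n h₁)
                      (t₂ : Hom (Γ ▷ E₂ [ n₂ ]) (W ▷ F)) (et₂ : 𝐩 F ∘ t₂ ≡ m ∘ ι₂ n h₂) where
        private
          open ClassifyBase n m
          c₁ : Hom Γ U₁
          c₁ = classifyM
          hc₁ : u₁ ∘ c₁ ≡ n
          hc₁ = classifyM-u₁
          module Extend₁ = Ext₁.Extend h₁ c₁ hc₁ t₁ (trans et₁ (sym (classifyM-m hc₁) ∘⟨ ι₁ n h₁))
          c₂ : Hom Γ U₂
          c₂ = Extend₁.extend
          hc₂ : u₂ ∘ c₂ ≡ n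
          hc₂ = trans (assoc u₁ Ext₁.p c₂) (trans (u₁ ⟩∘ Extend₁.extend-p) hc₁)
          module Extend₂ = Ext₂.Extend h₂ c₂ hc₂ t₂
                        (trans et₂ (trans (sym (classifyM-m hc₁)) (sym (m₂-lift hc₂ hc₁ Extend₁.extend-p)) ∘⟨ ι₂ n h₂))

        opaque
          classify : Hom Γ U₃
          classify = Extend₂.extend

          classify-τ : τ ∘ classify ≡ n
          classify-τ = trans (assoc u₂ Ext₂.p classify) (trans (u₂ ⟩∘ Extend₂.extend-p) hc₂)

          classify-m : ∀ hc → m̂ ∘ lift S τ classify hc ≡ m
          classify-m hc = trans (m̂-lift hc hc₂ hc₁ Extend₂.extend-p Extend₁.extend-p) (classifyM-m hc₁)

          classify-t₁ : ∀ hc → t̂₁ ∘ lift₂ E₁ π₁ τ classify hc h₁ ≡ t₁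
          classify-t₁ hc = trans (t̂₁-lift hc hc₂ h₁ Extend₂.extend-p) (Extend₁.extend-t̂ hc₂)

          classify-t₂ : ∀ hc → t̂₂ ∘ lift₂ E₂ π₂ τ classify hc h₂ ≡ t₂
          classify-t₂ = Extend₂.extend-t̂

          classify-unique : ∀ c (hc : τ ∘ c ≡ n) → m̂ ∘ lift S τ c hc ≡ m →
                            t̂₁ ∘ lift₂ E₁ π₁ τ c hc h₁ ≡ t₁ → t̂₂ ∘ lift₂ E₂ π₂ τ c hc h₂ ≡ t₂ → c ≡ classify
          classify-unique c hc em e₁ e₂ = Extend₂.extend-unique c p₃c≡c₂ hc e₂
            where
            h₂' : u₂ ∘ (Ext₂.p ∘ c) ≡ n
            h₂' = trans (sym (assoc u₂ Ext₂.p c)) hc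
            h₁' : u₁ ∘ (Ext₁.p ∘ (Ext₂.p ∘ c)) ≡ n
            h₁' = trans (sym (assoc u₁ Ext₁.p _)) h₂'
            p₂p₃c≡c₁ : Ext₁.p ∘ (Ext₂.p ∘ c) ≡ c₁
            p₂p₃c≡c₁ = classifyM-unique _ h₁' (trans (sym (m̂-lift hc h₂' h₁' refl refl)) em)
            p₃c≡c₂ : Ext₂.p ∘ c ≡ c₂
            p₃c≡c₂ = Extend₁.extend-unique _ p₂p₃c≡c₁ h₂' (trans (sym (t̂₁-lift hc h₂' h₁ refl)) e₁)

        copair : Hom (Γ ▷ S [ n ]) (W ▷ F)
        copair = ŝ ∘ lift S τ classify classify-τ

        copair-𝐩 : 𝐩 F ∘ copair ≡ m
        copair-𝐩 = trans (pullˡ ŝ-𝐩) (classify-m classify-τ)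

        copair-ι₁ : copair ∘ ι₁ n h₁ ≡ t₁
        copair-ι₁ = begin
          (ŝ ∘ L) ∘ ι₁ n h₁                                          ≡⟨ assoc ŝ L _ ⟩
          ŝ ∘ (L ∘ ι₁ n h₁)                                          ≡⟨ ŝ ⟩∘ lift-ι E₁ π₁ ν̄₁ τ classify classify-τ h₁ ⟩
          ŝ ∘ (proj₁ (reindexOver τ ν̄₁) ∘ lift₂ E₁ π₁ τ classify classify-τ h₁) ≡⟨ pullˡ ŝ-ν₁ ⟩
          t̂₁ ∘ lift₂ E₁ π₁ τ classify classify-τ h₁                  ≡⟨ classify-t₁ classify-τ ⟩
          t₁                                                          ∎
          where L = lift S τ classify classify-τ

        copair-ι₂ : copair ∘ ι₂ n h₂ ≡ t₂
        copair-ι₂ = begin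
          (ŝ ∘ L) ∘ ι₂ n h₂                                          ≡⟨ assoc ŝ L _ ⟩
          ŝ ∘ (L ∘ ι₂ n h₂)                                          ≡⟨ ŝ ⟩∘ lift-ι E₂ π₂ ν̄₂ τ classify classify-τ h₂ ⟩
          ŝ ∘ (proj₁ (reindexOver τ ν̄₂) ∘ lift₂ E₂ π₂ τ classify classify-τ h₂) ≡⟨ pullˡ ŝ-ν₂ ⟩
          t̂₂ ∘ lift₂ E₂ π₂ τ classify classify-τ h₂                  ≡⟨ classify-t₂ classify-τ ⟩
          t₂                                                          ∎
          where L = lift S τ classify classify-τ

      copair-reindex :
        ∀ {Γ Δ} (σ : Hom Δ Γ) {n : Hom Γ V} {n₁ : Hom Γ V₁} {n₂ : Hom Γ V₂} (h₁ : π₁ ∘ n ≡ n₁) (h₂ : π₂ ∘ n ≡ n₂)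
          (m : Hom (Γ ▷ S [ n ]) W)
          (t₁ : Hom (Γ ▷ E₁ [ n₁ ]) (W ▷ F)) (et₁ : 𝐩 F ∘ t₁ ≡ m ∘ ι₁ n h₁)
          (t₂ : Hom (Γ ▷ E₂ [ n₂ ]) (W ▷ F)) (et₂ : 𝐩 F ∘ t₂ ≡ m ∘ ι₂ n h₂)
          (h₁' : π₁ ∘ (n ∘ σ) ≡ n₁ ∘ σ) (h₂' : π₂ ∘ (n ∘ σ) ≡ n₂ ∘ σ)
          (t₁' : Hom (Δ ▷ E₁ [ n₁ ∘ σ ]) (W ▷ F)) (et₁' : 𝐩 F ∘ t₁' ≡ (m ∘ lift S n σ refl) ∘ ι₁ (n ∘ σ) h₁')
          (t₂' : Hom (Δ ▷ E₂ [ n₂ ∘ σ ]) (W ▷ F)) (et₂' : 𝐩 F ∘ t₂' ≡ (m ∘ lift S n σ refl) ∘ ι₂ (n ∘ σ) h₂') →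
          t₁' ≡ t₁ ∘ lift E₁ n₁ σ refl → t₂' ≡ t₂ ∘ lift E₂ n₂ σ refl →
          Classify.copair h₁' h₂' (m ∘ lift S n σ refl) t₁' et₁' t₂' et₂'
            ≡ Classify.copair h₁ h₂ m t₁ et₁ t₂ et₂ ∘ lift S n σ refl
      copair-reindex σ {n} {n₁} {n₂} h₁ h₂ m t₁ et₁ t₂ et₂ h₁' h₂' t₁' et₁' t₂' et₂' e₁ e₂ = begin
        ŝ ∘ lift S τ CΔ.classify CΔ.classify-τ                   ≡⟨ ŝ ⟩∘ sym (lift-∘ S τ CΓ.classify-τ refl CΔ.classify-τ cσ≡c') ⟩
        ŝ ∘ (lift S τ c CΓ.classify-τ ∘ lift S n σ refl)         ≡⟨ sym (assoc ŝ _ _) ⟩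
        (ŝ ∘ lift S τ c CΓ.classify-τ) ∘ lift S n σ refl         ∎
        where
        module CΓ = Classify h₁ h₂ m t₁ et₁ t₂ et₂
        module CΔ = Classify h₁' h₂' (m ∘ lift S n σ refl) t₁' et₁' t₂' et₂'
        c : Hom _ U₃
        c = CΓ.classify
        hc' : τ ∘ (c ∘ σ) ≡ n ∘ σ
        hc' = trans (sym (assoc τ c σ)) (CΓ.classify-τ ∘⟨ σ)
        cσ≡c' : c ∘ σ ≡ CΔ.classify
        cσ≡c' = CΔ.classify-unique (c ∘ σ) hc'
          (begin
            m̂ ∘ lift S τ (c ∘ σ) hc'                                ≡⟨ m̂ ⟩∘ sym (lift-∘ S τ CΓ.classify-τ refl hc' refl) ⟩
            m̂ ∘ (lift S τ c CΓ.classify-τ ∘ lift S n σ refl)        ≡⟨ sym (assoc m̂ _ _) ⟩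
            (m̂ ∘ lift S τ c CΓ.classify-τ) ∘ lift S n σ refl        ≡⟨ CΓ.classify-m _ ∘⟨ _ ⟩
            m ∘ lift S n σ refl                                      ∎)
          (begin
            t̂₁ ∘ lift₂ E₁ π₁ τ (c ∘ σ) hc' h₁'                               ≡⟨ t̂₁ ⟩∘ sym (lift₂-lift E₁ π₁ τ CΓ.classify-τ h₁ refl hc' h₁' refl) ⟩
            t̂₁ ∘ (lift₂ E₁ π₁ τ c CΓ.classify-τ h₁ ∘ lift E₁ n₁ σ refl)      ≡⟨ sym (assoc t̂₁ _ _) ⟩
            (t̂₁ ∘ lift₂ E₁ π₁ τ c CΓ.classify-τ h₁) ∘ lift E₁ n₁ σ refl      ≡⟨ CΓ.classify-t₁ _ ∘⟨ _ ⟩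
            t₁ ∘ lift E₁ n₁ σ refl                                            ≡⟨ sym e₁ ⟩
            t₁'                                                               ∎)
          (begin
            t̂₂ ∘ lift₂ E₂ π₂ τ (c ∘ σ) hc' h₂'                               ≡⟨ t̂₂ ⟩∘ sym (lift₂-lift E₂ π₂ τ CΓ.classify-τ h₂ refl hc' h₂' refl) ⟩
            t̂₂ ∘ (lift₂ E₂ π₂ τ c CΓ.classify-τ h₂ ∘ lift E₂ n₂ σ refl)      ≡⟨ sym (assoc t̂₂ _ _) ⟩
            (t̂₂ ∘ lift₂ E₂ π₂ τ c CΓ.classify-τ h₂) ∘ lift E₂ n₂ σ refl      ≡⟨ CΓ.classify-t₂ _ ∘⟨ _ ⟩
            t₂ ∘ lift E₂ n₂ σ refl                                            ≡⟨ sym e₂ ⟩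
            t₂'                                                               ∎)

    module _ {Vᵢ} (Eᵢ : Ty Vᵢ) (πᵢ : Hom V Vᵢ) (ν̄ : OverMap V (Eᵢ [ πᵢ ]) S) where
      ι-reindex! : ∀ {Γ Δ} (σ : Hom Δ Γ) {n : Hom Γ V} {nᵢ : Hom Γ Vᵢ} (hᵢ : πᵢ ∘ n ≡ nᵢ) {n' : Hom Δ V}
                   (p : n ∘ σ ≡ n') (hᵢ' : πᵢ ∘ n' ≡ nᵢ ∘ σ) →
                   proj₁ (N.substOver {A = Vᵢ , Eᵢ , nᵢ ∘ σ} (cong (λ k → V , S , k) p)
                            (N.reindexOver σ {A = Vᵢ , Eᵢ , nᵢ} {B = V , S , n} (ι Eᵢ πᵢ ν̄ n hᵢ , ι-𝐩 Eᵢ πᵢ ν̄ n hᵢ)))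
                   ≡ ι Eᵢ πᵢ ν̄ n' hᵢ'
      ι-reindex! σ {n} {nᵢ} hᵢ refl hᵢ' =
        pullback-jointly-monic (lift-pb S n σ refl) (sym (lift-𝐩 S n σ refl)) _ _
          (trans (proj₂ ν[σ]) (sym (ι-𝐩 Eᵢ πᵢ ν̄ (n ∘ σ) hᵢ')))
          (trans (N.reindexOver-sq σ {A = Vᵢ , Eᵢ , nᵢ} {B = V , S , n} ν) (sym (ι-reindex Eᵢ πᵢ ν̄ σ n hᵢ hᵢ')))
        where
        ν = (ι Eᵢ πᵢ ν̄ n hᵢ , ι-𝐩 Eᵢ πᵢ ν̄ n hᵢ)
        ν[σ] = N.reindexOver σ {A = Vᵢ , Eᵢ , nᵢ} {B = V , S , n} ν

    module CopairSect {Γ W} (F : Ty W) {n : Hom Γ V} {n₁ : Hom Γ V₁} {n₂ : Hom Γ V₂} (h₁ : π₁ ∘ n ≡ n₁) (h₂ : π₂ ∘ n ≡ n₂)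
                      (m : Hom (Γ ▷ S [ n ]) W) (t₁ : Sect (F [ m ∘ ι₁ n h₁ ])) (t₂ : Sect (F [ m ∘ ι₂ n h₂ ])) where
      open Universal.Classify F h₁ h₂ m (proj₁ (toSlice F _ t₁)) (proj₂ (toSlice F _ t₁))
                                        (proj₁ (toSlice F _ t₂)) (proj₂ (toSlice F _ t₂)) public

      opaque
        section : Sect (F [ m ])
        section = fromSlice F m (copair , copair-𝐩)

        section-𝐪 : proj₁ (toSlice F m section) ≡ copair
        section-𝐪 = toSlice-fromSlice F m (copair , copair-𝐩)

      section-ι₁ : proj₁ section ∘ ι₁ n h₁ ≡ lift F m (ι₁ n h₁) refl ∘ proj₁ t₁
      section-ι₁ = section-restriction F m _ section t₁ (trans (section-𝐪 ∘⟨ ι₁ n h₁) copair-ι₁)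

      section-ι₂ : proj₁ section ∘ ι₂ n h₂ ≡ lift F m (ι₂ n h₂) refl ∘ proj₁ t₂
      section-ι₂ = section-restriction F m _ section t₂ (trans (section-𝐪 ∘⟨ ι₂ n h₂) copair-ι₂)

    section-reindex :
      ∀ {Γ Δ W} (σ : Hom Δ Γ) (F : Ty W) {n : Hom Γ V} {n₁ : Hom Γ V₁} {n₂ : Hom Γ V₂} (h₁ : π₁ ∘ n ≡ n₁) (h₂ : π₂ ∘ n ≡ n₂)
        (m : Hom (Γ ▷ S [ n ]) W) (t₁ : Sect (F [ m ∘ ι₁ n h₁ ])) (t₂ : Sect (F [ m ∘ ι₂ n h₂ ]))
        (h₁' : π₁ ∘ (n ∘ σ) ≡ n₁ ∘ σ) (h₂' : π₂ ∘ (n ∘ σ) ≡ n₂ ∘ σ)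
        (t₁' : Sect (F [ (m ∘ lift S n σ refl) ∘ ι₁ (n ∘ σ) h₁' ])) (t₂' : Sect (F [ (m ∘ lift S n σ refl) ∘ ι₂ (n ∘ σ) h₂' ])) →
        proj₁ (toSlice F _ t₁') ≡ proj₁ (toSlice F _ t₁) ∘ lift E₁ n₁ σ refl →
        proj₁ (toSlice F _ t₂') ≡ proj₁ (toSlice F _ t₂) ∘ lift E₂ n₂ σ refl →
        proj₁ (N.reindexSect (lift S n σ refl) {A = W , F , m} (CopairSect.section F h₁ h₂ m t₁ t₂))
          ≡ proj₁ (CopairSect.section F h₁' h₂' (m ∘ lift S n σ refl) t₁' t₂')
    section-reindex σ F {n} h₁ h₂ m t₁ t₂ h₁' h₂' t₁' t₂' e₁ e₂ =
      𝐪-ext F (m ∘ L) (proj₁ (N.reindexSect L {A = _ , F , m} SΓ.section)) (proj₁ SΔ.section)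
        (begin
          𝐪 F (m ∘ L) ∘ proj₁ (N.reindexSect L {A = _ , F , m} SΓ.section) ≡⟨ toSlice-reindexSect! F m L SΓ.section ⟩
          proj₁ (toSlice F m SΓ.section) ∘ L                                ≡⟨ SΓ.section-𝐪 ∘⟨ L ⟩
          SΓ.copair ∘ L                                                     ≡⟨ sym copair-σ ⟩
          SΔ.copair                                                         ≡⟨ sym SΔ.section-𝐪 ⟩
          𝐪 F (m ∘ L) ∘ proj₁ SΔ.section                                    ∎)
        (trans (proj₂ (N.reindexSect L {A = _ , F , m} SΓ.section)) (sym (proj₂ SΔ.section)))
      where
      L = lift S n σ refl
      module SΓ = CopairSect F h₁ h₂ m t₁ t₂
      module SΔ = CopairSect F h₁' h₂' (m ∘ L) t₁' t₂'
      s₁ = toSlice F (m ∘ ι₁ n h₁) t₁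
      s₂ = toSlice F (m ∘ ι₂ n h₂) t₂
      s₁' = toSlice F ((m ∘ L) ∘ ι₁ (n ∘ σ) h₁') t₁'
      s₂' = toSlice F ((m ∘ L) ∘ ι₂ (n ∘ σ) h₂') t₂'
      copair-σ : SΔ.copair ≡ SΓ.copair ∘ L
      copair-σ = Universal.copair-reindex F σ h₁ h₂ m (proj₁ s₁) (proj₂ s₁) (proj₁ s₂) (proj₂ s₂) h₁' h₂'
                   (proj₁ s₁') (proj₂ s₁') (proj₁ s₂') (proj₂ s₂') e₁ e₂

    copair! : ∀ {Γ} {n : Hom Γ V} {n₁ : Hom Γ V₁} {n₂ : Hom Γ V₂} (h₁ : π₁ ∘ n ≡ n₁) (h₂ : π₂ ∘ n ≡ n₂)
              (C : Ty! 𝒯 (Γ ▷ S [ n ])) →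
              N.Sect (reindex! 𝒯 C (ι₁ n h₁)) → N.Sect (reindex! 𝒯 C (ι₂ n h₂)) → N.Sect C
    copair! h₁ h₂ (W , F , m) = CopairSect.section F h₁ h₂ m

    copair!-reindex :
      ∀ {Γ Δ W} (σ : Hom Δ Γ) (F : Ty W) {n : Hom Γ V} {n₁ : Hom Γ V₁} {n₂ : Hom Γ V₂} (h₁ : π₁ ∘ n ≡ n₁) (h₂ : π₂ ∘ n ≡ n₂)
        (m : Hom (Γ ▷ S [ n ]) W) (t₁ : Sect (F [ m ∘ ι₁ n h₁ ])) (t₂ : Sect (F [ m ∘ ι₂ n h₂ ]))
        {n' : Hom Δ V} (p : n ∘ σ ≡ n') (h₁' : π₁ ∘ n' ≡ n₁ ∘ σ) (h₂' : π₂ ∘ n' ≡ n₂ ∘ σ)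
        (q₁ : _≡_ {A = Ty! 𝒯 (Δ ▷ E₁ [ n₁ ∘ σ ])} (W , F , (m ∘ ι₁ n h₁) ∘ lift E₁ n₁ σ refl)
                 (reindex! 𝒯 (N.substTy (cong (λ k → V , S , k) p) (W , F , m ∘ lift S n σ refl)) (ι₁ n' h₁')))
        (q₂ : _≡_ {A = Ty! 𝒯 (Δ ▷ E₂ [ n₂ ∘ σ ])} (W , F , (m ∘ ι₂ n h₂) ∘ lift E₂ n₂ σ refl)
                 (reindex! 𝒯 (N.substTy (cong (λ k → V , S , k) p) (W , F , m ∘ lift S n σ refl)) (ι₂ n' h₂'))) →
        proj₁ (N.substSect (cong (λ k → V , S , k) p) (W , F , m ∘ lift S n σ refl)
                 (N.reindexSect (lift S n σ refl) (copair! h₁ h₂ (W , F , m) t₁ t₂)))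
          ≡ proj₁ (copair! h₁' h₂' (N.substTy (cong (λ k → V , S , k) p) (W , F , m ∘ lift S n σ refl))
                     (N.castSect q₁ (N.reindexSect (lift E₁ n₁ σ refl) t₁))
                     (N.castSect q₂ (N.reindexSect (lift E₂ n₂ σ refl) t₂)))
    copair!-reindex σ F h₁ h₂ m t₁ t₂ refl h₁' h₂' q₁ q₂ =
      section-reindex σ F h₁ h₂ m t₁ t₂ h₁' h₂' _ _
        (trans (toSlice-castSect! F q₁ _) (toSlice-reindexSect! F _ _ t₁))
        (trans (toSlice-castSect! F q₂ _) (toSlice-reindexSect! F _ _ t₂))

  module 𝒯! = FullCompCat (𝒯 !)

  infixl 6 _⊕!_

  _⊕!_ : ∀ {Γ} → Ty! 𝒯 Γ → Ty! 𝒯 Γ → Ty! 𝒯 Γ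
  (V₁ , E₁ , n₁) ⊕! (V₂ , E₂ , n₂) = V₁ ⊗ V₂ , SumOf.S E₁ E₂ , ⟨ n₁ , n₂ ⟩

  ν₁! : ∀ {Γ} (A₁ A₂ : Ty! 𝒯 Γ) → N.OverMap Γ A₁ (A₁ ⊕! A₂)
  ν₁! (V₁ , E₁ , n₁) (V₂ , E₂ , n₂) = ι₁ ⟨ n₁ , n₂ ⟩ (⟨⟩-π₁ n₁ n₂) , ι-𝐩 E₁ π₁ ν̄₁ ⟨ n₁ , n₂ ⟩ (⟨⟩-π₁ n₁ n₂)
    where open SumOf E₁ E₂

  ν₂! : ∀ {Γ} (A₁ A₂ : Ty! 𝒯 Γ) → N.OverMap Γ A₂ (A₁ ⊕! A₂)
  ν₂! (V₁ , E₁ , n₁) (V₂ , E₂ , n₂) = ι₂ ⟨ n₁ , n₂ ⟩ (⟨⟩-π₂ n₁ n₂) , ι-𝐩 E₂ π₂ ν̄₂ ⟨ n₁ , n₂ ⟩ (⟨⟩-π₂ n₁ n₂)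
    where open SumOf E₁ E₂

  copair⊕! : ∀ {Γ} {A₁ A₂ : Ty! 𝒯 Γ} (C : 𝒯!.Ty (Γ 𝒯!.▷ A₁ ⊕! A₂)) →
             N.Sect (C 𝒯!.[ proj₁ (ν₁! A₁ A₂) ]) → N.Sect (C 𝒯!.[ proj₁ (ν₂! A₁ A₂) ]) → N.Sect C
  copair⊕! {A₁ = V₁ , E₁ , n₁} {V₂ , E₂ , n₂} = SumOf.copair! E₁ E₂ (⟨⟩-π₁ n₁ n₂) (⟨⟩-π₂ n₁ n₂)

  ⊕!-stable : ∀ {Γ Δ} (σ : Hom Δ Γ) (A₁ A₂ : Ty! 𝒯 Γ) → (A₁ ⊕! A₂) 𝒯!.[ σ ] ≡ A₁ 𝒯!.[ σ ] ⊕! A₂ 𝒯!.[ σ ]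
  ⊕!-stable σ (V₁ , E₁ , n₁) (V₂ , E₂ , n₂) = cong (λ k → V₁ ⊗ V₂ , SumOf.S E₁ E₂ , k) (⟨⟩-∘ n₁ n₂ σ)

  strictlyStableSums : N.StrictlyStableSums (!-split 𝒯)
  strictlyStableSums = record
    { _⊕_       = _⊕!_
    ; ν₁        = ν₁!
    ; ν₂        = ν₂!
    ; copair    = copair⊕!
    ; copair-ν₁ = λ { {A₁ = V₁ , E₁ , n₁} {V₂ , E₂ , n₂} (W , F , m) t₁ t₂ →
                      SumOf.CopairSect.section-ι₁ E₁ E₂ F (⟨⟩-π₁ n₁ n₂) (⟨⟩-π₂ n₁ n₂) m t₁ t₂ }
    ; copair-ν₂ = λ { {A₁ = V₁ , E₁ , n₁} {V₂ , E₂ , n₂} (W , F , m) t₁ t₂ →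
                      SumOf.CopairSect.section-ι₂ E₁ E₂ F (⟨⟩-π₁ n₁ n₂) (⟨⟩-π₂ n₁ n₂) m t₁ t₂ }
    ; ⊕-stable  = ⊕!-stable
    ; ν₁-stable = λ { σ (V₁ , E₁ , n₁) (V₂ , E₂ , n₂) →
                      SumOf.ι-reindex! E₁ E₂ E₁ π₁ (SumOf.ν̄₁ E₁ E₂) σ (⟨⟩-π₁ n₁ n₂) (⟨⟩-∘ n₁ n₂ σ) (⟨⟩-π₁ (n₁ ∘ σ) (n₂ ∘ σ)) }
    ; ν₂-stable = λ { σ (V₁ , E₁ , n₁) (V₂ , E₂ , n₂) →
                      SumOf.ι-reindex! E₁ E₂ E₂ π₂ (SumOf.ν̄₂ E₁ E₂) σ (⟨⟩-π₂ n₁ n₂) (⟨⟩-∘ n₁ n₂ σ) (⟨⟩-π₂ (n₁ ∘ σ) (n₂ ∘ σ)) }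
    ; copair-stable = λ { σ (V₁ , E₁ , n₁) (V₂ , E₂ , n₂) (W , F , m) t₁ t₂ →
                          SumOf.copair!-reindex E₁ E₂ σ F (⟨⟩-π₁ n₁ n₂) (⟨⟩-π₂ n₁ n₂) m t₁ t₂ (⟨⟩-∘ n₁ n₂ σ)
                            (⟨⟩-π₁ (n₁ ∘ σ) (n₂ ∘ σ)) (⟨⟩-π₂ (n₁ ∘ σ) (n₂ ∘ σ)) _ _ }
    }

lemma3p4p1p4 : ∀ {o h t : Level} {𝒞 : Category o h} (𝒯 : FullCompCat 𝒞 t) →
    CompNotions.LF 𝒯 →
    CompNotions.HasWeaklyStableSums 𝒯 →
    CompNotions.StrictlyStableSums (𝒯 !) (!-split 𝒯)
lemma3p4p1p4 𝒯 lf ws = WeakSumsToStrict.strictlyStableSums 𝒯 lf ws
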